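{- Let $k\geqslant1$. For $n,r\geqslant0$ let $f_n^r(k)$ be the number of $132$-avoiding permutations in $\mathfrak S_n$ containing exactly $r$ occurrences of $12\dots k$, and $F(x,y;k)=\sum_{n,r\geqslant0}f_n^r(k)x^ny^r$. Let $R_j(x)$ be defined by $R_0=0$, $R_j=1/(1-xR_{j-1})$ for $j\geqslant1$, and let $$ G(x,y;k)=\cfrac{y}{1-\cfrac{xy^{\binom{k}{1}}}{1-\cfrac{xy^{\binom{k+1}{2}}}{1-\cfrac{xy^{\binom{k+2}{3}}}{\ddots}}}} $$ (the $i$th partial numerator below the top being $xy^{\binom{k+i-1}{i}}$, $i\geqslant1$). Then, as formal power series, $$ F(x,y;k)=R_k(x)+\big(R_k(x)-R_{k-1}(x)\big)\sum_{m\geqslant1}\big(xR_k(x)G(x,y;k)\big)^m. $$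
   Context: An occurrence of $12\dots k$ in $\pi\in\mathfrak S_n$ is a set of indices $i_1<\dots<i_k$ with $\pi_{i_1}<\dots<\pi_{i_k}$; $\pi$ is $132$-avoiding if there are no $i_1<i_2<i_3$ with $\pi_{i_1}<\pi_{i_3}<\pi_{i_2}$. The empty permutation is counted for $n=0$. -}

module Defs where

open import Data.Nat using (ℕ; zero; suc; _∸_; _≤?_; _<?_) renaming (_+_ to _+ℕ_)
open import Data.Nat.Combinatorics using (_C_)
open import Data.Integer using (ℤ; +_; _+_; _*_; _-_)
open import Data.Fin using (Fin; _<_)
import Data.Fin.Properties as FinP
open import Data.Vec using (Vec; []; _∷_; lookup; map)
open import Data.List using (List; []; _∷_; length; filter; concatMap; allFin; foldr; upTo)
open import Data.Product using (_×_; ∃; ∃-syntax; _,_)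
open import Relation.Binary.PropositionalEquality using (_≡_)
open import Relation.Nullary using (¬_; Dec; yes; no)
open import Relation.Nullary.Decidable using (_×-dec_; _→-dec_; ¬?)
import Data.Nat.Properties as ℕP
import Data.Fin as F

-- Permutations of [n] = {0,…,n-1} in one-line notation:
-- vectors π = π₀ … π_{n-1} of length n over Fin n with no repeated entry.

words : (n m : ℕ) → List (Vec (Fin m) n)
words zero    m = [] ∷ []
words (suc n) m = concatMap (λ i → Data.List.map (i ∷_) (words n m)) (allFin m)

IsPerm : ∀ {n} → Vec (Fin n) n → Set
IsPerm {n} π = ∀ (i j : Fin n) → lookup π i ≡ lookup π j → i ≡ j

isPerm? : ∀ {n} (π : Vec (Fin n) n) → Dec (IsPerm π)
isPerm? π = FinP.all? λ i → FinP.all? λ j → (lookup π i FinP.≟ lookup π j) →-dec (i FinP.≟ j)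

Contains132 : ∀ {n} → Vec (Fin n) n → Set
Contains132 {n} π = ∃[ i ] ∃[ j ] ∃[ l ]
  ((i < j × j < l) × (lookup π i < lookup π l × lookup π l < lookup π j))

contains132? : ∀ {n} (π : Vec (Fin n) n) → Dec (Contains132 π)
contains132? π = FinP.any? λ i → FinP.any? λ j → FinP.any? λ l →
  ((i FinP.<? j) ×-dec (j FinP.<? l)) ×-dec
  ((lookup π i FinP.<? lookup π l) ×-dec (lookup π l FinP.<? lookup π j))

Avoids132 : ∀ {n} → Vec (Fin n) n → Set
Avoids132 π = ¬ Contains132 π

Increasing : ∀ {k m} → Vec (Fin m) k → Set
Increasing {k} v = ∀ (a b : Fin k) → a < b → lookup v a < lookup v b

increasing? : ∀ {k m} (v : Vec (Fin m) k) → Dec (Increasing v)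
increasing? v = FinP.all? λ a → FinP.all? λ b → (a FinP.<? b) →-dec (lookup v a FinP.<? lookup v b)

IsOcc : ∀ {n} (k : ℕ) → Vec (Fin n) n → Vec (Fin n) k → Set
IsOcc k π ι = Increasing ι × Increasing (map (lookup π) ι)

isOcc? : ∀ {n} k (π : Vec (Fin n) n) (ι : Vec (Fin n) k) → Dec (IsOcc k π ι)
isOcc? k π ι = increasing? ι ×-dec increasing? (map (lookup π) ι)

occ : ∀ {n} (k : ℕ) → Vec (Fin n) n → ℕ
occ {n} k π = length (filter (isOcc? k π) (words k n))

f : (k n r : ℕ) → ℕ
f k n r = length (filter (λ π → isPerm? π ×-dec (¬? (contains132? π) ×-dec (occ k π Data.Nat.≟ r))) (words n n))

-- Formal power series in x, y with integer coefficients: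
-- A n r = coefficient of x^n y^r.

Series : Set
Series = ℕ → ℕ → ℤ

sumℤ : List ℤ → ℤ
sumℤ = foldr _+_ (+ 0)

Σ≤ : ℕ → (ℕ → ℤ) → ℤ
Σ≤ n g = sumℤ (Data.List.map g (upTo (suc n)))

zeroS : Series
zeroS _ _ = + 0

oneS : Series
oneS zero zero = + 1
oneS _    _    = + 0

yS : Series
yS zero (suc zero) = + 1
yS _    _          = + 0

_⊕_ : Series → Series → Series
(A ⊕ B) n r = A n r + B n r

_⊖_ : Series → Series → Series
(A ⊖ B) n r = A n r - B n r

_⊗_ : Series → Series → Series
(A ⊗ B) n r = Σ≤ n λ a → Σ≤ r λ b → A a b * B (n ∸ a) (r ∸ b)

xTimes : Series → Series
xTimes A zero    r = + 0
xTimes A (suc n) r = A n r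

yPowTimes : ℕ → Series → Series
yPowTimes c A n r with r Data.Nat.<? c
... | yes _ = + 0
... | no  _ = A n (r ∸ c)

powS : Series → ℕ → Series
powS A zero    = oneS
powS A (suc m) = A ⊗ powS A m

-- 1/(1 - x·B) = Σ_{m≥0} (x B)^m ; the coefficient of x^n only receives
-- contributions from m ≤ n, so this truncation is exact.
geomX : Series → Series
geomX B n r = Σ≤ n λ m → powS (xTimes B) m n r

R : ℕ → Series
R zero    = zeroS
R (suc j) = geomX (R j)

cExp : ℕ → ℕ → ℕ
cExp k i = (k +ℕ i ∸ 1) C i

cf : ℕ → ℕ → ℕ → Series
cf k zero    i = oneS
cf k (suc d) i = geomX (yPowTimes (cExp k i) (cf k d (suc i)))

Gconv : ℕ → ℕ → Series
Gconv k d = yS ⊗ cf k d 1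

-- right-hand side with G replaced by its depth-d convergent:
-- R_k + (R_k - R_{k-1}) Σ_{m≥1} (x R_k G)^m, where Σ_{m≥1} A^m = 1/(1-A) - 1
rhs : ℕ → ℕ → Series
rhs k d = R k ⊕ ((R k ⊖ R (k ∸ 1)) ⊗ (geomX (R k ⊗ Gconv k d) ⊖ oneS))

module Submission where

-- Split a 132-avoiding permutation of [n + 1] at its first letter v: the rest,
-- relabelled, is a 132-avoiding permutation σ of [n] in which every entry ≥ v is a
-- left-to-right maximum, and v adds binomial(n − v, k − 1) occurrences of 12…k. Reading
-- h = n − v as a height, the next height is anything ≥ h − 1, so these permutations are
-- weighted paths with step weight x y^binomial(h, k − 1); decomposing a path at its first
-- visit to height 0 shows that their generating function is the continued fraction
-- 1 / (1 − x y^(w 0) / (1 − x y^(w 1) / ⋯)). As binomial(h, k − 1) vanishes for h < k − 1,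
-- that fraction is k − 1 levels of 1 / (1 − x ·) on top of 1 / (1 − x G). Finally, with
-- geom b = 1 / (1 − x b), the identity R (j+1) + (R (j+1) − R j) (geom (R (j+1) G) − 1)
-- = geom^(j+1) G holds in every commutative ring with such an operator, by induction on j.

open import Algebra.Bundles using (CommutativeMonoid; CommutativeRing)
open import Data.Nat.Base using (ℕ)

module RangeSum {a ℓ} (M : CommutativeMonoid a ℓ) where

  open import Data.Nat.Base as ℕ using (ℕ; zero; suc; _∸_; _≤_; _<_)
  open import Data.Nat.Properties using (m≤m+n; m≤n⇒∃[o]m+o≡n)
  open import Data.Fin.Base using (toℕ)
  open import Data.Fin.Properties using (toℕ<n; opposite-prop)
  import Data.Fin.Permutation as Perm
  open import Data.Product.Base using (_,_)
  open import Function.Base using (_∘_)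
  open import Relation.Binary.PropositionalEquality.Core using (refl; cong)

  open CommutativeMonoid M
    renaming (_∙_ to _+_; ε to 0#; ∙-congˡ to +-congˡ; identityˡ to +-identityˡ; identityʳ to +-identityʳ; assoc to +-assoc)
  open import Algebra.Properties.CommutativeMonoid.Sum M
    using (sum; sum-cong-≋; sum-replicate-zero; sum-permute; ∑-distrib-+)
  open import Relation.Binary.Reasoning.Setoid setoid

  ∑< : ℕ → (ℕ → Carrier) → Carrier
  ∑< n g = sum {n} (g ∘ toℕ)

  ∑<-cong : ∀ n {g h} → (∀ i → i < n → g i ≈ h i) → ∑< n g ≈ ∑< n h
  ∑<-cong n g≈h = sum-cong-≋ λ i → g≈h (toℕ i) (toℕ<n i)

  ∑<-zero : ∀ n {g} → (∀ i → i < n → g i ≈ 0#) → ∑< n g ≈ 0#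
  ∑<-zero n g≈0 = trans (∑<-cong n g≈0) (sum-replicate-zero n)

  ∑<-distrib : ∀ n g h → ∑< n (λ i → g i + h i) ≈ ∑< n g + ∑< n h
  ∑<-distrib n g h = ∑-distrib-+ {n} (g ∘ toℕ) (h ∘ toℕ)

  ∑<-reverse : ∀ n g → ∑< n g ≈ ∑< n (λ i → g (n ∸ suc i))
  ∑<-reverse n g = trans (sum-permute {n} (g ∘ toℕ) Perm.reverse)
    (sum-cong-≋ {n} λ i → reflexive (cong g (opposite-prop i)))

  ∑<-split : ∀ m j g → ∑< (m ℕ.+ j) g ≈ ∑< m g + ∑< j (λ i → g (m ℕ.+ i))
  ∑<-split zero    j g = sym (+-identityˡ _)
  ∑<-split (suc m) j g = trans (+-congˡ (∑<-split m j (g ∘ suc))) (sym (+-assoc _ _ _))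

  ∑<-truncate : ∀ {m n} g → m ≤ n → (∀ i → m ≤ i → g i ≈ 0#) → ∑< n g ≈ ∑< m g
  ∑<-truncate {m} g m≤n g≈0 with m≤n⇒∃[o]m+o≡n m≤n
  ... | j , refl = begin
    ∑< (m ℕ.+ j) g                     ≈⟨ ∑<-split m j g ⟩
    ∑< m g + ∑< j (λ i → g (m ℕ.+ i))  ≈⟨ +-congˡ (∑<-zero j λ i _ → g≈0 (m ℕ.+ i) (m≤m+n m i)) ⟩
    ∑< m g + 0#                        ≈⟨ +-identityʳ _ ⟩
    ∑< m g                             ∎

module PowerSeries {a ℓ} (R : CommutativeRing a ℓ) where

  open import Algebra.Structures using (IsCommutativeRing)
  import Algebra.Construct.Pointwise as Pointwise
  open import Data.Nat.Base using (ℕ; zero; suc; _∸_; _≤_; _<_; s≤s; s≤s⁻¹)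
  open import Data.Nat.Induction using (<-rec)
  open import Data.Nat.Properties using (m∸[m∸n]≡n; m∸n≤m)
  open import Data.Fin.Base using (toℕ)
  open import Data.Product.Base using (_,_)
  open import Function.Base using (_∘_)
  open import Relation.Binary.PropositionalEquality.Core using (cong)

  open CommutativeRing R hiding (zero)
  open import Algebra.Properties.Semiring.Sum semiring using (*-distribˡ-sum)
  open RangeSum +-commutativeMonoid
  open import Relation.Binary.Reasoning.Setoid setoid

  Seq : Set a
  Seq = ℕ → Carrier

  infix 4 _≋_
  _≋_ : Seq → Seq → Set ℓ
  u ≋ v = ∀ n → u n ≈ v n

  ⊟_ : Seq → Seq
  (⊟ u) n = - u n

  𝟘 : Seq
  𝟘 _ = 0#

  const : Carrier → Seq
  const c zero    = c
  const c (suc _) = 0#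

  𝟙 : Seq
  𝟙 = const 1#

  shift : Seq → Seq
  shift u zero    = 0#
  shift u (suc n) = u n

  shift-cong : ∀ {u v} → u ≋ v → shift u ≋ shift v
  shift-cong u≈v zero    = refl
  shift-cong u≈v (suc n) = u≈v n

  infixl 6 _⊞_
  infixl 7 _⊛_

  -- The ring operations are opaque, so that unification with ring expressions never unfolds a convolution.
  opaque
    _⊞_ : Seq → Seq → Seq
    (u ⊞ v) n = u n + v n

    ⊞-def : ∀ u v n → (u ⊞ v) n ≈ u n + v n
    ⊞-def u v n = refl

    _⊛_ : Seq → Seq → Seq
    (u ⊛ v) n = ∑< (suc n) λ i → u i * v (n ∸ i)

    ⊞-congˡ : ∀ {u v v′} n → v n ≈ v′ n → (u ⊞ v) n ≈ (u ⊞ v′) n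
    ⊞-congˡ n = +-congˡ

    ⊛-def : ∀ u v n → (u ⊛ v) n ≈ ∑< (suc n) λ i → u i * v (n ∸ i)
    ⊛-def u v n = refl

    ⊛-local : ∀ n {u u′ v v′} → (∀ m → m ≤ n → u m ≈ u′ m) → (∀ m → m ≤ n → v m ≈ v′ m) →
              (u ⊛ v) n ≈ (u′ ⊛ v′) n
    ⊛-local n u≈u′ v≈v′ = ∑<-cong (suc n) λ i i<1+n →
      *-cong (u≈u′ i (s≤s⁻¹ i<1+n)) (v≈v′ (n ∸ i) (m∸n≤m n i))

    ⊛-distribʳ : ∀ w u v → (u ⊞ v) ⊛ w ≋ u ⊛ w ⊞ v ⊛ w
    ⊛-distribʳ w u v n = trans (∑<-cong (suc n) λ i _ → distribʳ (w (n ∸ i)) (u i) (v i))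
      (∑<-distrib (suc n) (λ i → u i * w (n ∸ i)) (λ i → v i * w (n ∸ i)))

    ⊛-zeroˡ : ∀ v → 𝟘 ⊛ v ≋ 𝟘
    ⊛-zeroˡ v n = ∑<-zero (suc n) λ i _ → zeroˡ (v (n ∸ i))

    const-⊛ : ∀ c v → const c ⊛ v ≋ λ n → c * v n
    const-⊛ c v zero    = +-identityʳ _
    const-⊛ c v (suc n) = trans (+-congˡ (⊛-zeroˡ v n)) (+-identityʳ _)

    ⊛-scaleˡ : ∀ c u v n → ((λ i → c * u i) ⊛ v) n ≈ c * (u ⊛ v) n
    ⊛-scaleˡ c u v n = trans (∑<-cong (suc n) λ i _ → *-assoc c (u i) (v (n ∸ i)))
      (sym (*-distribˡ-sum {suc n} c ((λ i → u i * v (n ∸ i)) ∘ toℕ)))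

    ⊛-comm : ∀ u v → u ⊛ v ≋ v ⊛ u
    ⊛-comm u v n = trans (∑<-reverse (suc n) λ i → u i * v (n ∸ i)) (∑<-cong (suc n) λ i i<1+n →
      trans (*-comm (u (n ∸ i)) _) (*-congʳ (reflexive (cong v (m∸[m∸n]≡n (s≤s⁻¹ i<1+n))))))

    -- By computation, (u ⊛ v) (suc n) is u 0 * v (suc n) + ((u ∘ suc) ⊛ v) n.
    ⊛-assoc : ∀ u v w → (u ⊛ v) ⊛ w ≋ u ⊛ (v ⊛ w)
    ⊛-assoc u v w zero    = +-congʳ {0#} (trans (*-congʳ (+-identityʳ _))
      (trans (*-assoc _ _ _) (*-congˡ (sym (+-identityʳ _)))))
    ⊛-assoc u v w (suc n) = begin
      (u 0 * v 0 + 0#) * w (suc n) + (((λ i → u 0 * v (suc i)) ⊞ (u ∘ suc) ⊛ v) ⊛ w) n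
        ≈⟨ +-cong (*-congʳ (+-identityʳ _)) (⊛-distribʳ w (λ i → u 0 * v (suc i)) ((u ∘ suc) ⊛ v) n) ⟩
      u 0 * v 0 * w (suc n) + (((λ i → u 0 * v (suc i)) ⊛ w) n + (((u ∘ suc) ⊛ v) ⊛ w) n)
        ≈⟨ +-cong (*-assoc _ _ _) (+-cong (⊛-scaleˡ (u 0) (v ∘ suc) w n) (⊛-assoc (u ∘ suc) v w n)) ⟩
      u 0 * (v 0 * w (suc n)) + (u 0 * ((v ∘ suc) ⊛ w) n + ((u ∘ suc) ⊛ (v ⊛ w)) n)
        ≈⟨ sym (+-assoc _ _ _) ⟩
      u 0 * (v 0 * w (suc n)) + u 0 * ((v ∘ suc) ⊛ w) n + ((u ∘ suc) ⊛ (v ⊛ w)) n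
        ≈⟨ +-congʳ (sym (distribˡ (u 0) _ _)) ⟩
      u 0 * (v ⊛ w) (suc n) + ((u ∘ suc) ⊛ (v ⊛ w)) n
        ∎

    ⊛-identityˡ : ∀ v → 𝟙 ⊛ v ≋ v
    ⊛-identityˡ v zero    = trans (+-identityʳ _) (*-identityˡ _)
    ⊛-identityˡ v (suc n) = trans (+-congˡ (⊛-zeroˡ v n)) (trans (+-identityʳ _) (*-identityˡ _))

    ⊛-shiftˡ : ∀ u v → shift u ⊛ v ≋ shift (u ⊛ v)
    ⊛-shiftˡ u v zero    = trans (+-identityʳ _) (zeroˡ _)
    ⊛-shiftˡ u v (suc n) = trans (+-congʳ (zeroˡ _)) (+-identityˡ _)

    ⊛-cong : ∀ {u u′ v v′} → u ≋ u′ → v ≋ v′ → u ⊛ v ≋ u′ ⊛ v′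
    ⊛-cong u≈u′ v≈v′ n = ⊛-local n (λ m _ → u≈u′ m) (λ m _ → v≈v′ m)

    powerSeries-isCommutativeRing : IsCommutativeRing _≋_ _⊞_ _⊛_ ⊟_ 𝟘 𝟙
    powerSeries-isCommutativeRing = record
      { isRing = record
        { +-isAbelianGroup = Pointwise.isAbelianGroup ℕ +-isAbelianGroup
        ; *-cong           = ⊛-cong
        ; *-assoc          = ⊛-assoc
        ; *-identity       = ⊛-identityˡ , λ v n → trans (⊛-comm v 𝟙 n) (⊛-identityˡ v n)
        ; distrib          = (λ w u v n → trans (⊛-comm w (u ⊞ v) n)
                                            (trans (⊛-distribʳ w u v n) (+-cong (⊛-comm u w n) (⊛-comm v w n))))
                           , ⊛-distribʳ
        }
      ; *-comm = ⊛-comm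
      }

  powerSeriesRing : CommutativeRing a ℓ
  powerSeriesRing = record { isCommutativeRing = powerSeries-isCommutativeRing }

  ⊛-shiftˡ-local : ∀ n u {v v′} → (∀ m → m < n → v m ≈ v′ m) → (shift u ⊛ v) n ≈ (shift u ⊛ v′) n
  ⊛-shiftˡ-local zero    u {v} {v′} _     = trans (⊛-shiftˡ u v 0) (sym (⊛-shiftˡ u v′ 0))
  ⊛-shiftˡ-local (suc n) u {v} {v′} v≈v′ = trans (⊛-shiftˡ u v (suc n)) (trans
    (⊛-local n (λ _ _ → refl) (λ m m≤n → v≈v′ m (s≤s m≤n))) (sym (⊛-shiftˡ u v′ (suc n))))

  shift-fixpoint-unique : ∀ {c u v w} → v ≋ c ⊞ shift u ⊛ v → w ≋ c ⊞ shift u ⊛ w → v ≋ w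
  shift-fixpoint-unique {c} {u} {v} {w} v-fix w-fix = <-rec (λ n → v n ≈ w n) λ n v≈w →
    trans (v-fix n) (trans (⊞-congˡ n (⊛-shiftˡ-local n u λ m m<n → v≈w m<n)) (sym (w-fix n)))

  module ∑ₛ = RangeSum (CommutativeRing.+-commutativeMonoid powerSeriesRing)

  ∑ₛ-apply : ∀ k F n → ∑ₛ.∑< k F n ≈ ∑< k λ i → F i n
  ∑ₛ-apply zero    F n = refl
  ∑ₛ-apply (suc k) F n = trans (⊞-def (F 0) (∑ₛ.∑< k (F ∘ suc)) n) (+-congˡ (∑ₛ-apply k (F ∘ suc) n))

module ContinuedFractionAlgebra {a ℓ} (𝓡 : CommutativeRing a ℓ) where

  open CommutativeRing 𝓡
  open import Data.Nat.Base using (ℕ; zero; suc)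
  open import Algebra.Properties.AbelianGroup +-abelianGroup using (xyx⁻¹≈y)
  open import Algebra.Solver.Ring.NaturalCoefficients.Default commutativeSemiring
    using (solve; Polynomial; _:+_; _:*_; _:=_; con)
  open import Relation.Binary.Reasoning.Setoid setoid

  module Geometric
    (X : Carrier) (geom : Carrier → Carrier)
    (geom-fix : ∀ b → geom b ≈ 1# + X * b * geom b)
    (geom-unique : ∀ b {y} → y ≈ 1# + X * b * y → y ≈ geom b)
    where

    geom-cong : ∀ {b b′} → b ≈ b′ → geom b ≈ geom b′
    geom-cong {b} {b′} b≈b′ = geom-unique b′ (trans (geom-fix b) (+-congˡ (*-congʳ (*-congˡ b≈b′))))

    geom-zero : geom 0# ≈ 1#
    geom-zero = sym (geom-unique 0# (sym (trans (+-congˡ (trans (*-congʳ (zeroʳ X)) (zeroˡ 1#))) (+-identityʳ 1#))))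

    geom-+ : ∀ b e → geom (b + e) ≈ geom b + X * e * geom b * geom (b + e)
    geom-+ b e = sym (geom-unique (b + e) (begin
      g + X * e * g * g′                                        ≈⟨ +-cong (geom-fix b) (*-congˡ (geom-fix (b + e))) ⟩
      (1# + X * b * g) + X * e * g * (1# + X * (b + e) * g′)    ≈⟨ solve 5 (λ X b e g g′ →
         (con 1 :+ X :* b :* g) :+ X :* e :* g :* (con 1 :+ X :* (b :+ e) :* g′)
           := con 1 :+ X :* (b :+ e) :* (g :+ X :* e :* g :* g′)) refl X b e g g′ ⟩
      1# + X * (b + e) * (g + X * e * g * g′)                   ∎))
      where
      g  = geom b
      g′ = geom (b + e)

    geom-step : ∀ {b b′} e → b′ ≈ b + e → geom b′ ≈ geom b + X * e * geom b * geom b′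
    geom-step {b} e b′≈b+e = trans (geom-cong b′≈b+e)
      (trans (geom-+ b e) (+-congˡ (*-congˡ (geom-cong (sym b′≈b+e)))))

    geom-∸1 : ∀ b → geom b - 1# ≈ X * b * geom b
    geom-∸1 b = trans (+-congʳ (geom-fix b)) (xyx⁻¹≈y 1# _)

    iterate : ℕ → Carrier → Carrier
    iterate zero    G = G
    iterate (suc j) G = geom (iterate j G)

    iterate-cong : ∀ j {G G′} → G ≈ G′ → iterate j G ≈ iterate j G′
    iterate-cong zero    G≈G′ = G≈G′
    iterate-cong (suc j) G≈G′ = geom-cong (iterate-cong j G≈G′)

    iterate-sucʳ : ∀ j G → iterate (suc j) G ≈ iterate j (geom G)
    iterate-sucʳ zero    G = refl
    iterate-sucʳ (suc j) G = geom-cong (iterate-sucʳ j G)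

    R : ℕ → Carrier
    R j = iterate j 0#

    -- δ j is R (j + 1) − R j, computed without subtraction.
    δ : ℕ → Carrier
    δ zero    = 1#
    δ (suc j) = X * δ j * R (suc j) * R (suc (suc j))

    R-suc : ∀ j → R (suc j) ≈ R j + δ j
    R-suc zero    = trans geom-zero (sym (+-identityˡ 1#))
    R-suc (suc j) = geom-step (δ j) (R-suc j)

    -- Subtraction-free form of R (j + 1) + (R (j + 1) − R j) (geom (R (j + 1) G) − 1).
    Φ : ℕ → Carrier → Carrier
    Φ j G = R (suc j) + δ j * (X * (R (suc j) * G) * geom (R (suc j) * G))

    Φ-zero : ∀ G → Φ 0 G ≈ geom G
    Φ-zero G = begin
      R 1 + 1# * (X * (R 1 * G) * geom (R 1 * G))  ≈⟨ +-cong geom-zero (*-congˡ (*-cong (*-congˡ 1G≈G) (geom-cong 1G≈G))) ⟩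
      1# + 1# * (X * G * geom G)                    ≈⟨ +-congˡ (*-identityˡ _) ⟩
      1# + X * G * geom G                           ≈⟨ geom-fix G ⟨
      geom G                                        ∎
      where
      1G≈G : R 1 * G ≈ G
      1G≈G = trans (*-congʳ geom-zero) (*-identityˡ G)

    Φ-suc : ∀ j G → Φ (suc j) G ≈ geom (Φ j G)
    Φ-suc j G = geom-unique (Φ j G) (begin
      Φ′                                                 ≈⟨ solve 6 (λ X d r r′ G q′ →
                                                              Φ′-expr X d r r′ G q′ := r′ :+ c-expr X d r r′ G q′ :* r′) refl X (δ j) r r′ G q′ ⟩
      r′ + c * r′                                        ≈⟨ +-cong (geom-fix r) (*-congˡ (geom-fix r)) ⟩
      (1# + X * r * r′) + c * (1# + X * r * r′)          ≈⟨ solve 6 (λ X d r r′ G q′ →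
                                                              (con 1 :+ X :* r :* r′) :+ c-expr X d r r′ G q′ :* (con 1 :+ X :* r :* r′)
                                                              := con 1 :+ X :* r :* Φ′-expr X d r r′ G q′ :+ X :* d :* X :* r :* G :* (r′ :* q′))
                                                            refl X (δ j) r r′ G q′ ⟩
      1# + X * r * Φ′ + X * δ j * X * r * G * (r′ * q′)  ≈⟨ +-congˡ (*-congˡ r′q′≈qΦ′) ⟩
      1# + X * r * Φ′ + X * δ j * X * r * G * (q * Φ′)   ≈⟨ solve 7 (λ X d r r′ G q′ q →
                                                              con 1 :+ X :* r :* Φ′-expr X d r r′ G q′ :+ X :* d :* X :* r :* G :* (q :* Φ′-expr X d r r′ G q′)
                                                              := con 1 :+ X :* (r :+ d :* (X :* (r :* G) :* q)) :* Φ′-expr X d r r′ G q′)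
                                                            refl X (δ j) r r′ G q′ q ⟩
      1# + X * Φ j G * Φ′                                ∎)
      where
      r  = R (suc j)
      r′ = R (suc (suc j))
      q  = geom (r * G)
      q′ = geom (r′ * G)
      Φ′ = Φ (suc j) G
      c  = X * δ j * X * r * G * r′ * q′
      c-expr Φ′-expr : ∀ {n} (X d r r′ G q′ : Polynomial n) → Polynomial n
      c-expr  X d r r′ G q′ = X :* d :* X :* r :* G :* r′ :* q′
      Φ′-expr X d r r′ G q′ = r′ :+ X :* d :* r :* r′ :* (X :* (r′ :* G) :* q′)
      r′q′≈qΦ′ : r′ * q′ ≈ q * Φ′
      r′q′≈qΦ′ = begin
        r′ * q′                                  ≈⟨ *-congˡ (geom-step (δ (suc j) * G) (trans (*-congʳ (R-suc (suc j))) (distribʳ G r (δ (suc j))))) ⟩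
        r′ * (q + X * (δ (suc j) * G) * q * q′)  ≈⟨ solve 7 (λ X d r r′ G q′ q →
                                                      r′ :* (q :+ X :* (X :* d :* r :* r′ :* G) :* q :* q′) := q :* Φ′-expr X d r r′ G q′)
                                                    refl X (δ j) r r′ G q′ q ⟩
        q * Φ′                                   ∎

    Φ≈iterate : ∀ j G → Φ j G ≈ iterate (suc j) G
    Φ≈iterate zero    G = Φ-zero G
    Φ≈iterate (suc j) G = trans (Φ-suc j G) (geom-cong (Φ≈iterate j G))

    R+ΔR*[geom-1]≈iterate : ∀ j G → R (suc j) + (R (suc j) - R j) * (geom (R (suc j) * G) - 1#) ≈ iterate (suc j) G
    R+ΔR*[geom-1]≈iterate j G = trans
      (+-congˡ (*-cong (trans (+-congʳ (R-suc j)) (xyx⁻¹≈y (R j) (δ j))) (geom-∸1 (R (suc j) * G))))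
      (Φ≈iterate j G)

module BivariateSeries where

  open import Defs
  open import Algebra.Bundles using (CommutativeRing)
  open import Algebra.Properties.Semiring.Sum using (*-distribˡ-sum)
  open import Data.Nat using (ℕ; zero; suc; _∸_; _≤_; _<_; s≤s; s≤s⁻¹; _<?_)
  open import Data.Nat.Properties using (<-≤-trans; n≤1+n; <⇒≤; <⇒≱)
  open import Data.Fin.Base using (toℕ)
  open import Data.Integer.Base as ℤ using (ℤ; +_)
  open import Data.Integer.Properties using (+-*-commutativeRing)
  open import Data.List.Base using (applyUpTo)
  open import Data.Empty using (⊥-elim)
  open import Function.Base using (_∘_)
  open import Relation.Nullary.Decidable.Core using (yes; no)
  open import Relation.Binary.PropositionalEquality using (_≡_; refl; cong; trans; sym; module ≡-Reasoning)

  -- Series = ℤ[[y]][[x]]: the outer index is the exponent of x.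
  module ℤ[[y]] = PowerSeries +-*-commutativeRing
  module 𝕊 = PowerSeries ℤ[[y]].powerSeriesRing
  module ∑ℤ = RangeSum (CommutativeRing.+-commutativeMonoid +-*-commutativeRing)

  seriesRing : CommutativeRing _ _
  seriesRing = 𝕊.powerSeriesRing

  open CommutativeRing seriesRing hiding (zero) renaming (refl to ≈-refl; sym to ≈-sym; trans to ≈-trans)

  module ∑𝕊 = RangeSum +-commutativeMonoid

  Σ≤≡∑< : ∀ n g → Σ≤ n g ≡ ∑ℤ.∑< (suc n) g
  Σ≤≡∑< n g = go (suc n) (λ i → i)
    where
    go : ∀ m f → sumℤ (Data.List.Base.map g (applyUpTo f m)) ≡ ∑ℤ.∑< m (g ∘ f)
    go zero    f = refl
    go (suc m) f = cong (λ s → g (f 0) ℤ.+ s) (go m (f ∘ suc))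

  coeff-∑< : ∀ k F n r → ∑𝕊.∑< k F n r ≡ ∑ℤ.∑< k (λ i → F i n r)
  coeff-∑< k F n r = trans (𝕊.∑ₛ-apply k F n r) (ℤ[[y]].∑ₛ-apply k (λ i → F i n) r)

  ∑𝕊-at : ∀ k {F G} n → (∀ i → i < k → F i n ℤ[[y]].≋ G i n) → ∑𝕊.∑< k F n ℤ[[y]].≋ ∑𝕊.∑< k G n
  ∑𝕊-at k {F} {G} n F≋G r = trans (coeff-∑< k F n r)
    (trans (∑ℤ.∑<-cong k λ i i<k → F≋G i i<k r) (sym (coeff-∑< k G n r)))

  *-distribˡ-∑< : ∀ n A F → A * ∑𝕊.∑< n F ≈ ∑𝕊.∑< n (λ i → A * F i)
  *-distribˡ-∑< n A F = *-distribˡ-sum semiring {n} A (F ∘ toℕ)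

  ⊕≈+ : ∀ A B → A ⊕ B ≈ A + B
  ⊕≈+ A B n r = sym (trans (𝕊.⊞-def A B n r) (ℤ[[y]].⊞-def (A n) (B n) r))

  ⊖≈- : ∀ A B → A ⊖ B ≈ A - B
  ⊖≈- A B n r = sym (trans (𝕊.⊞-def A (- B) n r) (ℤ[[y]].⊞-def (A n) ((- B) n) r))

  ⊗≈* : ∀ A B → A ⊗ B ≈ A * B
  ⊗≈* A B n r = begin
    (A ⊗ B) n r                                               ≡⟨ Σ≤≡∑< n (λ a → Σ≤ r (term a)) ⟩
    ∑ℤ.∑< (suc n) (λ a → Σ≤ r (term a))                       ≡⟨ ∑ℤ.∑<-cong (suc n) (λ a _ → Σ≤≡∑< r (term a)) ⟩
    ∑ℤ.∑< (suc n) (λ a → ∑ℤ.∑< (suc r) (term a))              ≡⟨ ∑ℤ.∑<-cong (suc n) (λ a _ → sym (ℤ[[y]].⊛-def (A a) (B (n ∸ a)) r)) ⟩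
    ∑ℤ.∑< (suc n) (λ a → (A a ℤ[[y]].⊛ B (n ∸ a)) r)          ≡⟨ sym (ℤ[[y]].∑ₛ-apply (suc n) (λ a → A a ℤ[[y]].⊛ B (n ∸ a)) r) ⟩
    ℤ[[y]].∑ₛ.∑< (suc n) (λ a → A a ℤ[[y]].⊛ B (n ∸ a)) r     ≡⟨ sym (𝕊.⊛-def A B n r) ⟩
    (A * B) n r                                               ∎
    where
    open ≡-Reasoning
    term : ℕ → ℕ → ℤ
    term a b = A a b ℤ.* B (n ∸ a) (r ∸ b)

  oneS≈1 : oneS ≈ 1#
  oneS≈1 zero    zero    = refl
  oneS≈1 zero    (suc r) = refl
  oneS≈1 (suc n) r       = refl

  X : Series
  X = 𝕊.shift 1#

  X*≈shift : ∀ A → X * A ≈ 𝕊.shift A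
  X*≈shift A = ≈-trans (𝕊.⊛-shiftˡ 1# A) (𝕊.shift-cong (𝕊.⊛-identityˡ A))

  xTimes≈X* : ∀ A → xTimes A ≈ X * A
  xTimes≈X* A = ≈-trans xTimes≈shift (≈-sym (X*≈shift A))
    where
    xTimes≈shift : xTimes A ≈ 𝕊.shift A
    xTimes≈shift zero    r = refl
    xTimes≈shift (suc n) r = refl

  yPow : ℕ → ℤ[[y]].Seq
  yPow zero    = ℤ[[y]].𝟙
  yPow (suc c) = ℤ[[y]].shift (yPow c)

  Y : ℕ → Series
  Y c = 𝕊.const (yPow c)

  yPowTimes-suc : ∀ c A n r → yPowTimes (suc c) A n (suc r) ≡ yPowTimes c A n r
  yPowTimes-suc c A n r with suc r <? suc c | r <? c
  ... | yes _       | yes _   = refl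
  ... | no _        | no _    = refl
  ... | yes 1+r<1+c | no r≮c  = ⊥-elim (r≮c (s≤s⁻¹ 1+r<1+c))
  ... | no 1+r≮1+c  | yes r<c = ⊥-elim (1+r≮1+c (s≤s r<c))

  yPowTimes≋yPow⊛ : ∀ c A n → yPowTimes c A n ℤ[[y]].≋ yPow c ℤ[[y]].⊛ A n
  yPowTimes≋yPow⊛ zero    A n r       = sym (ℤ[[y]].⊛-identityˡ (A n) r)
  yPowTimes≋yPow⊛ (suc c) A n zero    = sym (ℤ[[y]].⊛-shiftˡ (yPow c) (A n) 0)
  yPowTimes≋yPow⊛ (suc c) A n (suc r) = trans (yPowTimes-suc c A n r)
    (trans (yPowTimes≋yPow⊛ c A n r) (sym (ℤ[[y]].⊛-shiftˡ (yPow c) (A n) (suc r))))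

  yPowTimes≈Y* : ∀ c A → yPowTimes c A ≈ Y c * A
  yPowTimes≈Y* c A n r = trans (yPowTimes≋yPow⊛ c A n r) (sym (𝕊.const-⊛ (yPow c) A n r))

  yPowTimes-zero : ∀ A → yPowTimes 0 A ≈ A
  yPowTimes-zero A n r = refl

  yPowTimes-cong : ∀ {c c′ A B} → c ≡ c′ → A ≈ B → yPowTimes c A ≈ yPowTimes c′ B
  yPowTimes-cong {c} {A = A} {B} refl A≈B = ≈-trans (yPowTimes≈Y* c A) (≈-trans (*-congˡ A≈B) (≈-sym (yPowTimes≈Y* c B)))

  yPowTimes-< : ∀ {c r} A n → r < c → yPowTimes c A n r ≡ + 0
  yPowTimes-< {c} {r} A n r<c with r <? c
  ... | yes _   = refl
  ... | no r≮c = ⊥-elim (r≮c r<c)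

  yPowTimes-≥ : ∀ {c r} A n → c ≤ r → yPowTimes c A n r ≡ A n (r ∸ c)
  yPowTimes-≥ {c} {r} A n c≤r with r <? c
  ... | yes r<c = ⊥-elim (<⇒≱ r<c c≤r)
  ... | no _    = refl

  yS≈Y1 : yS ≈ Y 1
  yS≈Y1 zero    zero          = refl
  yS≈Y1 zero    (suc zero)    = refl
  yS≈Y1 zero    (suc (suc r)) = refl
  yS≈Y1 (suc n) r             = refl

  xB^m-vanish : ∀ B m n → n < m → powS (xTimes B) m n ℤ[[y]].≋ ℤ[[y]].𝟘
  xB^m-vanish B (suc m) n n<1+m r = begin
    (xTimes B ⊗ xB^ m) n r          ≡⟨ ⊗≈* (xTimes B) (xB^ m) n r ⟩
    (xTimes B * xB^ m) n r          ≡⟨ *-congʳ {xB^ m} (xTimes≈X* B) n r ⟩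
    (X * B * xB^ m) n r             ≡⟨ *-congʳ {xB^ m} (X*≈shift B) n r ⟩
    (𝕊.shift B * xB^ m) n r         ≡⟨ 𝕊.⊛-shiftˡ-local n B {xB^ m} {0#} (λ k k<n → xB^m-vanish B m k (<-≤-trans k<n (s≤s⁻¹ n<1+m))) r ⟩
    (𝕊.shift B * 0#) n r            ≡⟨ zeroʳ (𝕊.shift B) n r ⟩
    + 0                             ∎
    where
    open ≡-Reasoning
    xB^ = powS (xTimes B)

  geomX-eval : ∀ B {n N} → n ≤ N → geomX B n ℤ[[y]].≋ ∑𝕊.∑< (suc N) (powS (xTimes B)) n
  geomX-eval B {n} {N} n≤N r = begin
    geomX B n r                        ≡⟨ Σ≤≡∑< n (λ m → xB^ m n r) ⟩
    ∑ℤ.∑< (suc n) (λ m → xB^ m n r)    ≡⟨ sym (∑ℤ.∑<-truncate (λ m → xB^ m n r) (s≤s n≤N) λ m n<m → xB^m-vanish B m n n<m r) ⟩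
    ∑ℤ.∑< (suc N) (λ m → xB^ m n r)    ≡⟨ sym (coeff-∑< (suc N) xB^ n r) ⟩
    ∑𝕊.∑< (suc N) xB^ n r              ∎
    where
    open ≡-Reasoning
    xB^ = powS (xTimes B)

  geomX-fix : ∀ B → geomX B ≈ 1# + X * B * geomX B
  geomX-fix B n = begin
    geomX B n                          ≈⟨ geomX-eval B (n≤1+n n) ⟩
    ∑𝕊.∑< (suc (suc n)) xB^ n          ≈⟨ +-congˡ {oneS} (∑𝕊.∑<-cong (suc n) λ m _ → xTimes⊗≈shift* (xB^ m)) n ⟩
    (oneS + ∑𝕊.∑< (suc n) (λ m → 𝕊.shift B * xB^ m)) n ≈⟨ +-cong oneS≈1 (≈-sym (*-distribˡ-∑< (suc n) (𝕊.shift B) xB^)) n ⟩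
    (1# + 𝕊.shift B * S) n             ≈⟨ 𝕊.⊞-congˡ n (𝕊.⊛-shiftˡ-local n B λ m m<n r → sym (geomX-eval B (<⇒≤ m<n) r)) ⟩
    (1# + 𝕊.shift B * geomX B) n       ≈⟨ +-congˡ (*-congʳ (≈-sym (X*≈shift B))) n ⟩
    (1# + X * B * geomX B) n           ∎
    where
    open import Relation.Binary.Reasoning.Setoid (CommutativeRing.setoid ℤ[[y]].powerSeriesRing)
    xB^ = powS (xTimes B)
    S = ∑𝕊.∑< (suc n) xB^
    xTimes⊗≈shift* : ∀ A → xTimes B ⊗ A ≈ 𝕊.shift B * A
    xTimes⊗≈shift* A = ≈-trans (⊗≈* (xTimes B) A) (*-congʳ (≈-trans (xTimes≈X* B) (X*≈shift B)))

  geomX-unique : ∀ B {V} → V ≈ 1# + X * B * V → V ≈ geomX B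
  geomX-unique B V-fix = 𝕊.shift-fixpoint-unique (shift-form V-fix) (shift-form (geomX-fix B))
    where
    shift-form : ∀ {W} → W ≈ 1# + X * B * W → W ≈ 1# + 𝕊.shift B * W
    shift-form W-fix = ≈-trans W-fix (+-congˡ (*-congʳ (X*≈shift B)))

  module GeomX = ContinuedFractionAlgebra.Geometric seriesRing X geomX geomX-fix geomX-unique

module RightHandSide where

  open import Defs using (R; rhs; Gconv; geomX)
  open BivariateSeries
  open import Algebra.Bundles using (CommutativeRing)
  open import Data.Nat.Base using (zero; suc)
  open import Relation.Binary.PropositionalEquality.Core using (refl)

  open CommutativeRing seriesRing hiding (zero) renaming (refl to ≈-refl; sym to ≈-sym; trans to ≈-trans)

  R≈GeomX-R : ∀ j → R j ≈ GeomX.R j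
  R≈GeomX-R zero    = λ _ _ → refl
  R≈GeomX-R (suc j) = GeomX.geom-cong (R≈GeomX-R j)

  rhs≈iterate : ∀ j d → rhs (suc j) d ≈ GeomX.iterate (suc j) (Gconv (suc j) d)
  rhs≈iterate j d = begin
    rhs (suc j) d
      ≈⟨ ≈-trans (⊕≈+ _ _) (+-congˡ (≈-trans (⊗≈* _ _) (*-cong (⊖≈- _ _) (≈-trans (⊖≈- _ _)
           (+-cong (GeomX.geom-cong (⊗≈* _ _)) (-‿cong oneS≈1)))))) ⟩
    R (suc j) + (R (suc j) - R j) * (geomX (R (suc j) * G) - 1#)
      ≈⟨ +-cong r≈ (*-cong (+-cong r≈ (-‿cong (R≈GeomX-R j))) (+-congʳ (GeomX.geom-cong (*-congʳ r≈)))) ⟩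
    GeomX.R (suc j) + (GeomX.R (suc j) - GeomX.R j) * (geomX (GeomX.R (suc j) * G) - 1#)
      ≈⟨ GeomX.R+ΔR*[geom-1]≈iterate j G ⟩
    GeomX.iterate (suc j) G
      ∎
    where
    open import Relation.Binary.Reasoning.Setoid setoid
    G = Gconv (suc j) d
    r≈ = R≈GeomX-R (suc j)

module WeightedPaths where

  open import Defs using (Series; oneS; geomX; yPowTimes)
  open BivariateSeries
  open import Algebra.Bundles using (CommutativeRing)
  open import Data.Bool.Base using (Bool; true; false; if_then_else_; _∧_; not; T)
  open import Data.Nat.Base as ℕ using (ℕ; zero; suc; _∸_; _<_; _<ᵇ_; s≤s; s≤s⁻¹; z≤n)
  open import Data.Nat.Properties using (<ᵇ-reflects-<; <ᵇ⇒<; ≮⇒≥; ≤-trans; +-0-commutativeMonoid)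
  open import Data.Integer.Base as ℤ using (ℤ; +_)
  open import Data.Integer.Properties using (pos-+)
  open import Function.Base using (_∘_)
  open import Relation.Nullary.Reflects using (ofʸ; ofⁿ)
  open import Relation.Binary.PropositionalEquality using (_≡_; refl; cong; cong₂; trans; sym; module ≡-Reasoning)
  open import Data.Empty using (⊥-elim)

  open CommutativeRing seriesRing hiding (zero) renaming (refl to ≈-refl; sym to ≈-sym; trans to ≈-trans)
  module ∑ℕ = RangeSum +-0-commutativeMonoid

  origin : ℕ → ℕ → ℕ
  origin zero zero = 1
  origin _    _    = 0

  -- paths D w h n r counts the sequences h = h₁, …, hₙ of heights below D with
  -- h_{i+1} ≥ hᵢ ∸ 1 and hₙ = 0 whose weight w h₁ + ⋯ + w hₙ is r.
  paths : ℕ → (ℕ → ℕ) → ℕ → ℕ → ℕ → ℕ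
  paths D w h zero    r = 0
  paths D w h (suc n) r =
    if (h <ᵇ D) ∧ not (r <ᵇ w h)
    then (if h <ᵇ 1 then origin n (r ∸ w h) else 0)
         ℕ.+ ∑ℕ.∑< D (λ h′ → if h <ᵇ 2 ℕ.+ h′ then paths D w h′ n (r ∸ w h) else 0)
    else 0

  if-zero : ∀ b {x} → (T b → x ≡ 0) → (if b then x else 0) ≡ 0
  if-zero true  x≡0 = x≡0 _
  if-zero false _   = refl

  -- Each step descends by at most one, so height 0 is out of reach from height h in h steps.
  paths-vanish : ∀ D w n h r → n ℕ.≤ h → paths D w h n r ≡ 0
  paths-vanish D w zero    h       r _          = refl
  paths-vanish D w (suc n) (suc h) r (s≤s n≤h) = if-zero _ λ _ → ∑ℕ.∑<-zero D λ h′ _ →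
    if-zero (suc h <ᵇ 2 ℕ.+ h′) λ h<2+h′ → paths-vanish D w n h′ _ (≤-trans n≤h (s≤s⁻¹ (s≤s⁻¹ (<ᵇ⇒< _ _ h<2+h′))))

  pathS : ℕ → (ℕ → ℕ) → ℕ → Series
  pathS D w h n r = + paths D w h n r

  allPaths : ℕ → (ℕ → ℕ) → Series
  allPaths D w = 1# + ∑𝕊.∑< D (pathS D w)

  gate : Bool → Series → Series
  gate true  A = A
  gate false _ = 0#

  +∑ℕ< : ∀ k g → + ∑ℕ.∑< k g ≡ ∑ℤ.∑< k (λ i → + g i)
  +∑ℕ< zero    g = refl
  +∑ℕ< (suc k) g = trans (pos-+ (g 0) _) (cong (ℤ._+_ (+ g 0)) (+∑ℕ< k (g ∘ suc)))

  +if : ∀ b {m} A n r → + m ≡ A n r → + (if b then m else 0) ≡ gate b A n r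
  +if true  A n r eq = eq
  +if false A n r eq = refl

  +origin : ∀ n r → + origin n r ≡ 1# n r
  +origin zero    zero    = refl
  +origin zero    (suc r) = refl
  +origin (suc n) r       = refl

  pos-+-coeff : ∀ a b A B n r → + a ≡ A n r → + b ≡ B n r → + (a ℕ.+ b) ≡ (A + B) n r
  pos-+-coeff a b A B n r a≡ b≡ = trans (pos-+ a b) (trans (cong₂ ℤ._+_ a≡ b≡)
    (sym (trans (𝕊.⊞-def A B n r) (ℤ[[y]].⊞-def (A n) (B n) r))))

  X*-zero : ∀ A r → (X * A) 0 r ≡ + 0
  X*-zero A r = X*≈shift A 0 r

  X*-suc : ∀ A n r → (X * A) (suc n) r ≡ A n r
  X*-suc A n r = X*≈shift A (suc n) r

  pathS-step : ∀ {D} w h → h < D → pathS D w h ≈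
    X * (Y (w h) * (gate (h <ᵇ 1) 1# + ∑𝕊.∑< D λ h′ → gate (h <ᵇ 2 ℕ.+ h′) (pathS D w h′)))
  pathS-step w h h<D zero r = sym (X*-zero _ r)
  pathS-step {D} w h h<D (suc n) r with h <ᵇ D | <ᵇ-reflects-< h D
  ... | false | ofⁿ h≮D = ⊥-elim (h≮D h<D)
  ... | true  | _ with r <ᵇ w h | <ᵇ-reflects-< r (w h)
  ...   | true  | ofʸ r<c = sym (trans (X*-suc _ n r) (trans (sym (yPowTimes≈Y* (w h) _ n r)) (yPowTimes-< _ n r<c)))
  ...   | false | ofⁿ r≮c = sym (trans (X*-suc _ n r) (trans (sym (yPowTimes≈Y* (w h) _ n r))
                                (trans (yPowTimes-≥ _ n (≮⇒≥ r≮c)) (sym step))))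
    where
    r′ = r ∸ w h
    F = λ h′ → gate (h <ᵇ 2 ℕ.+ h′) (pathS D w h′)
    step : + ((if h <ᵇ 1 then origin n r′ else 0) ℕ.+ ∑ℕ.∑< D (λ h′ → if h <ᵇ 2 ℕ.+ h′ then paths D w h′ n r′ else 0))
         ≡ (gate (h <ᵇ 1) 1# + ∑𝕊.∑< D F) n r′
    step = pos-+-coeff _ _ (gate (h <ᵇ 1) 1#) (∑𝕊.∑< D F) n r′ (+if (h <ᵇ 1) 1# n r′ (+origin n r′))
      (trans (+∑ℕ< D λ h′ → if h <ᵇ 2 ℕ.+ h′ then paths D w h′ n r′ else 0)
             (trans (∑ℤ.∑<-cong D λ h′ _ → +if (h <ᵇ 2 ℕ.+ h′) (pathS D w h′) n r′ refl) (sym (coeff-∑< D F n r′))))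

  gate-cong : ∀ b {A B} → A ≈ B → gate b A ≈ gate b B
  gate-cong true  A≈B = A≈B
  gate-cong false _   = ≈-refl

  gate-* : ∀ b A B → A * gate b B ≈ gate b (A * B)
  gate-* true  A B = ≈-refl
  gate-* false A B = zeroʳ A

  gate-at : ∀ b {A B} n → A n ℤ[[y]].≋ B n → gate b A n ℤ[[y]].≋ gate b B n
  gate-at true  n A≋B = A≋B
  gate-at false n A≋B r = refl

  Y*-at : ∀ c {A B} n → A n ℤ[[y]].≋ B n → (Y c * A) n ℤ[[y]].≋ (Y c * B) n
  Y*-at c {A} {B} n A≋B r = trans (𝕊.const-⊛ (yPow c) A n r)
    (trans (ℤ[[y]].⊛-cong {yPow c} {yPow c} (λ _ → refl) A≋B r) (sym (𝕊.const-⊛ (yPow c) B n r)))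

  prefix : ℕ → (ℕ → ℕ) → ℕ → Series
  prefix D w zero    = 1#
  prefix D w (suc h) = pathS D (w ∘ suc) h

  module _ (D : ℕ) (w : ℕ → ℕ) where

    private
      𝒫  = allPaths (suc D) w
      Y₀ = Y (w 0)
      open import Algebra.Solver.CommutativeMonoid *-commutativeMonoid using (solve; _⊕_; _⊜_; id)

      reassoc : ∀ p → 𝒫 * (X * (Y₀ * p)) ≈ 𝒫 * (X * Y₀) * p
      reassoc p = solve 4 (λ t x y p → t ⊕ (x ⊕ (y ⊕ p)) ⊜ (t ⊕ (x ⊕ y)) ⊕ p) ≈-refl 𝒫 X Y₀ p

    -- A path starting at h is a path above height 0 down to height 1, a step to
    -- height 0, and an arbitrary path from there on.
    pathS-firstVisit : ∀ h → h < suc D → pathS (suc D) w h ≈ 𝒫 * (X * (Y₀ * prefix D w h))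
    pathS-firstVisit h h<1+D n = firstVisit-at n h h<1+D
      where
      Q : ℕ → Series
      Q h = 𝒫 * (X * (Y₀ * prefix D w h))

      firstVisit-zero : pathS (suc D) w 0 ≈ Q 0
      firstVisit-zero = ≈-trans (pathS-step w 0 (s≤s z≤n))
        (solve 3 (λ x y t → x ⊕ (y ⊕ t) ⊜ t ⊕ (x ⊕ (y ⊕ id))) ≈-refl X Y₀ 𝒫)

      firstVisit-suc : ∀ h₀ → h₀ < D →
        X * (Y (w (suc h₀)) * (0# + ∑𝕊.∑< (suc D) λ h′ → gate (suc h₀ <ᵇ 2 ℕ.+ h′) (Q h′))) ≈ Q (suc h₀)
      firstVisit-suc h₀ h₀<D = begin
        X * (Y₁ * (0# + ∑𝕊.∑< (suc D) λ h′ → gate (b h′) (Q h′)))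
          ≈⟨ *-congˡ (*-congˡ (≈-trans (+-identityˡ _) (≈-trans
               (∑𝕊.∑<-cong (suc D) λ h′ _ → ≈-trans (gate-cong (b h′) (reassoc (prefix D w h′))) (≈-sym (gate-* (b h′) c (prefix D w h′))))
               (≈-sym (*-distribˡ-∑< (suc D) c λ h′ → gate (b h′) (prefix D w h′)))))) ⟩
        X * (Y₁ * (c * Inner))
          ≈⟨ solve 5 (λ x y₁ t y₀ i → x ⊕ (y₁ ⊕ ((t ⊕ (x ⊕ y₀)) ⊕ i)) ⊜ t ⊕ (x ⊕ (y₀ ⊕ (x ⊕ (y₁ ⊕ i))))) ≈-refl X Y₁ 𝒫 Y₀ Inner ⟩
        𝒫 * (X * (Y₀ * (X * (Y₁ * Inner))))
          ≈⟨ *-congˡ (*-congˡ (*-congˡ (≈-sym (pathS-step (w ∘ suc) h₀ h₀<D)))) ⟩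
        Q (suc h₀)
          ∎
        where
        open import Relation.Binary.Reasoning.Setoid setoid
        Y₁ = Y (w (suc h₀))
        b = λ h′ → suc h₀ <ᵇ 2 ℕ.+ h′
        c = 𝒫 * (X * Y₀)
        Inner = gate (h₀ <ᵇ 1) 1# + ∑𝕊.∑< D λ i → gate (h₀ <ᵇ 2 ℕ.+ i) (pathS D (w ∘ suc) i)

      firstVisit-at : ∀ n h → h < suc D → pathS (suc D) w h n ℤ[[y]].≋ Q h n
      firstVisit-at n       zero     _            = firstVisit-zero n
      firstVisit-at zero    (suc h₀) _          r = sym (trans (Q≈X* 0 r) (X*-zero _ r))
        where
        Q≈X* : Q (suc h₀) ≈ X * (𝒫 * (Y₀ * prefix D w (suc h₀)))
        Q≈X* = solve 4 (λ t x y p → t ⊕ (x ⊕ (y ⊕ p)) ⊜ x ⊕ (t ⊕ (y ⊕ p))) ≈-refl 𝒫 X Y₀ (prefix D w (suc h₀))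
      firstVisit-at (suc n) (suc h₀) (s≤s h₀<D) r = begin
        pathS (suc D) w (suc h₀) (suc n) r   ≡⟨ pathS-step w (suc h₀) (s≤s h₀<D) (suc n) r ⟩
        (X * (Y₁ * S)) (suc n) r             ≡⟨ X*-suc _ n r ⟩
        (Y₁ * S) n r                         ≡⟨ Y*-at (w (suc h₀)) n S≋S′ r ⟩
        (Y₁ * S′) n r                        ≡⟨ X*-suc _ n r ⟨
        (X * (Y₁ * S′)) (suc n) r            ≡⟨ firstVisit-suc h₀ h₀<D (suc n) r ⟩
        Q (suc h₀) (suc n) r                 ∎
        where
        open ≡-Reasoning
        Y₁ = Y (w (suc h₀))
        b = λ h′ → suc h₀ <ᵇ 2 ℕ.+ h′
        S  = 0# + ∑𝕊.∑< (suc D) λ h′ → gate (b h′) (pathS (suc D) w h′)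
        S′ = 0# + ∑𝕊.∑< (suc D) λ h′ → gate (b h′) (Q h′)
        S≋S′ : S n ℤ[[y]].≋ S′ n
        S≋S′ = 𝕊.⊞-congˡ n (∑𝕊-at (suc D) {λ h′ → gate (b h′) (pathS (suc D) w h′)} {λ h′ → gate (b h′) (Q h′)} n
                 λ h′ h′<1+D → gate-at (b h′) {pathS (suc D) w h′} {Q h′} n (firstVisit-at n h′ h′<1+D))

    allPaths-suc : allPaths (suc D) w ≈ geomX (Y₀ * allPaths D (w ∘ suc))
    allPaths-suc = geomX-unique _ (begin
      1# + ∑𝕊.∑< (suc D) (pathS (suc D) w)                 ≈⟨ +-congˡ (∑𝕊.∑<-cong (suc D) λ h h<1+D →
                                                                ≈-trans (pathS-firstVisit h h<1+D) (reassoc (prefix D w h))) ⟩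
      1# + ∑𝕊.∑< (suc D) (λ h → 𝒫 * (X * Y₀) * prefix D w h) ≈⟨ +-congˡ (≈-sym (*-distribˡ-∑< (suc D) (𝒫 * (X * Y₀)) (prefix D w))) ⟩
      1# + 𝒫 * (X * Y₀) * allPaths D (w ∘ suc)               ≈⟨ +-congˡ (solve 4 (λ t x y a → (t ⊕ (x ⊕ y)) ⊕ a ⊜ (x ⊕ (y ⊕ a)) ⊕ t)
                                                                                  ≈-refl 𝒫 X Y₀ (allPaths D (w ∘ suc))) ⟩
      1# + X * (Y₀ * allPaths D (w ∘ suc)) * 𝒫               ∎)
      where open import Relation.Binary.Reasoning.Setoid setoid

  contFrac : (ℕ → ℕ) → ℕ → Series
  contFrac w zero    = oneS
  contFrac w (suc D) = geomX (yPowTimes (w 0) (contFrac (w ∘ suc) D))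

  contFrac≈allPaths : ∀ D w → contFrac w D ≈ allPaths D w
  contFrac≈allPaths zero    w = ≈-trans oneS≈1 (≈-sym (+-identityʳ 1#))
  contFrac≈allPaths (suc D) w = ≈-trans
    (GeomX.geom-cong (≈-trans (yPowTimes≈Y* (w 0) _) (*-congˡ (contFrac≈allPaths D (w ∘ suc)))))
    (≈-sym (allPaths-suc D w))

  allPaths-coeff : ∀ D w n r → allPaths D w n r ≡ 1# n r ℤ.+ + ∑ℕ.∑< D (λ h → paths D w h n r)
  allPaths-coeff D w n r = begin
    (1# + ∑𝕊.∑< D (pathS D w)) n r                        ≡⟨ trans (𝕊.⊞-def 1# _ n r) (ℤ[[y]].⊞-def (1# n) _ r) ⟩
    1# n r ℤ.+ ∑𝕊.∑< D (pathS D w) n r                    ≡⟨ cong (ℤ._+_ (1# n r)) (trans (coeff-∑< D (pathS D w) n r) (sym (+∑ℕ< D λ h → paths D w h n r))) ⟩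
    1# n r ℤ.+ + ∑ℕ.∑< D (λ h → paths D w h n r)          ∎
    where open ≡-Reasoning

module Counting where

  open import Defs using (words)
  open import Data.Nat.Base using (ℕ; zero; suc; _+_; _*_)
  open import Data.Nat.Properties using (+-0-commutativeMonoid; +-identityʳ)
  open import Data.Fin.Base using (Fin; zero; suc; punchIn)
  open import Data.Fin.Properties using (punchInᵢ≢i; _≟_)
  open import Data.List.Base as List using (List; []; _∷_; _++_; length; filter; concatMap; tabulate)
  open import Data.List.Properties using (filter-≐; filter-none; filter-++; length-++)
  import Data.List.Relation.Unary.All as ListAll
  open import Data.Vec.Base as Vec using (Vec; []; _∷_; map)
  open import Data.Vec.Relation.Unary.All using (All; []; _∷_; all?)
  open import Data.Product.Base using (_×_; _,_; proj₁; proj₂)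
  open import Function.Base using (_∘_)
  open import Level using (Level)
  open import Relation.Nullary using (¬_; Dec; yes; no; ¬?; contradiction)
  open import Relation.Nullary.Decidable using (_×-dec_)
  open import Relation.Unary using (Pred; Decidable)
  open import Relation.Binary.PropositionalEquality using (_≡_; _≢_; refl; cong; cong₂; trans; sym; module ≡-Reasoning)
  open import Algebra.Properties.CommutativeMonoid.Sum +-0-commutativeMonoid
    using (sum; sum-syntax; sum-cong-≗; sum-remove)

  private
    variable
      a p q : Level
      A B : Set a

  count : {P : Pred A p} → Decidable P → List A → ℕ
  count P? xs = length (filter P? xs)

  indicator : {P : Set p} → Dec P → ℕ
  indicator (yes _) = 1
  indicator (no _)  = 0

  indicator-cong : {P : Set p} {Q : Set q} → (P → Q) → (Q → P) → (P? : Dec P) (Q? : Dec Q) → indicator P? ≡ indicator Q?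
  indicator-cong P⇒Q Q⇒P (yes _) (yes _) = refl
  indicator-cong P⇒Q Q⇒P (no _)  (no _)  = refl
  indicator-cong P⇒Q Q⇒P (yes p) (no ¬q) = contradiction (P⇒Q p) ¬q
  indicator-cong P⇒Q Q⇒P (no ¬p) (yes q) = contradiction (Q⇒P q) ¬p

  indicator-yes : {P : Set p} (P? : Dec P) → P → indicator P? ≡ 1
  indicator-yes (yes _) _ = refl
  indicator-yes (no ¬p) p = contradiction p ¬p

  indicator-no : {P : Set p} (P? : Dec P) → ¬ P → indicator P? ≡ 0
  indicator-no (yes p) ¬p = contradiction p ¬p
  indicator-no (no _)  _  = refl

  module _ {P : Pred A p} (P? : Decidable P) where

    count-none : (∀ x → ¬ P x) → ∀ xs → count P? xs ≡ 0
    count-none ¬P xs = cong length (filter-none P? (ListAll.universal ¬P xs))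

    count-[_] : ∀ x → count P? (x ∷ []) ≡ indicator (P? x)
    count-[ x ] with P? x
    ... | yes _ = refl
    ... | no _  = refl

    count-++ : ∀ xs ys → count P? (xs ++ ys) ≡ count P? xs + count P? ys
    count-++ xs ys = trans (cong length (filter-++ P? xs ys)) (length-++ (filter P? xs))

    count-map : (g : B → A) → ∀ xs → count P? (List.map g xs) ≡ count (P? ∘ g) xs
    count-map g []       = refl
    count-map g (x ∷ xs) with P? (g x)
    ... | yes _ = cong suc (count-map g xs)
    ... | no _  = count-map g xs

    count-concatMap-tabulate : ∀ {m} (f : Fin m → B) (g : B → List A) →
                               count P? (concatMap g (tabulate f)) ≡ ∑[ i < m ] count P? (g (f i))
    count-concatMap-tabulate {m = zero}  f g = refl
    count-concatMap-tabulate {m = suc m} f g =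
      trans (count-++ (g (f zero)) _) (cong (count P? (g (f zero)) +_) (count-concatMap-tabulate (f ∘ suc) g))

  count-cong : {P : Pred A p} {Q : Pred A q} (P? : Decidable P) (Q? : Decidable Q) →
               (∀ {x} → P x → Q x) → (∀ {x} → Q x → P x) → ∀ xs → count P? xs ≡ count Q? xs
  count-cong P? Q? P⇒Q Q⇒P xs = cong length (filter-≐ P? Q? (P⇒Q , Q⇒P) xs)

  count-×-dec : {P : Pred A p} {Q : Set q} (P? : Decidable P) (Q? : Dec Q) →
                ∀ xs → count (λ x → P? x ×-dec Q?) xs ≡ indicator Q? * count P? xs
  count-×-dec P? (yes q) xs = trans (count-cong _ P? proj₁ (_, q) xs) (sym (+-identityʳ _))
  count-×-dec P? (no ¬q) xs = count-none _ (λ _ → ¬q ∘ proj₂) xs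

  count-words-suc : ∀ {n m} {P : Pred (Vec (Fin m) (suc n)) p} (P? : Decidable P) →
                    count P? (words (suc n) m) ≡ ∑[ i < m ] count (λ w → P? (i ∷ w)) (words n m)
  count-words-suc {n = n} {m} P? = trans (count-concatMap-tabulate P? (λ i → i) (λ i → List.map (i ∷_) (words n m)))
    (sum-cong-≗ λ i → count-map P? (i ∷_) (words n m))

  count-avoiding : ∀ n {m} (v : Fin (suc m)) {P : Pred (Vec (Fin (suc m)) n) p} (P? : Decidable P) →
    count (λ w → all? (λ x → ¬? (x ≟ v)) w ×-dec P? w) (words n (suc m)) ≡ count (P? ∘ map (punchIn v)) (words n m)
  count-avoiding zero {m} v P? = trans (count-[_] (λ w → all? (λ x → ¬? (x ≟ v)) w ×-dec P? w) Vec.[])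
    (trans (indicator-cong proj₂ ([] ,_) _ _) (sym (count-[_] (λ (σ : Vec (Fin m) 0) → P? (map (punchIn v) σ)) Vec.[])))
  count-avoiding (suc n) {m} v {P} P? = begin
    count (λ w → avoids? w ×-dec P? w) (words (suc n) (suc m))          ≡⟨ count-words-suc (λ w → avoids? w ×-dec P? w) ⟩
    sum H                                                               ≡⟨ sum-remove {i = v} H ⟩
    H v + ∑[ j < m ] H (punchIn v j)                                    ≡⟨ cong₂ _+_ (count-none _ (λ { _ ((v≢v ∷ _) , _) → v≢v refl }) (words n (suc m)))
                                                                                      (sum-cong-≗ H∘punchIn) ⟩
    ∑[ j < m ] count (λ σ → P? (punchIn v j ∷ map (punchIn v) σ)) (words n m) ≡⟨ sym (count-words-suc (P? ∘ map (punchIn v))) ⟩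
    count (P? ∘ map (punchIn v)) (words (suc n) m)                       ∎
    where
    open ≡-Reasoning
    avoids? : ∀ {k} (w : Vec (Fin (suc m)) k) → Dec (All (_≢ v) w)
    avoids? = all? (λ x → ¬? (x ≟ v))
    H : Fin (suc m) → ℕ
    H i = count (λ w → avoids? (i ∷ w) ×-dec P? (i ∷ w)) (words n (suc m))
    H∘punchIn : ∀ j → H (punchIn v j) ≡ count (λ σ → P? (punchIn v j ∷ map (punchIn v) σ)) (words n m)
    H∘punchIn j = trans
      (count-cong _ (λ w → avoids? w ×-dec P? (punchIn v j ∷ w))
        (λ { ((_ ∷ av) , p) → av , p }) (λ { (av , p) → (punchInᵢ≢i v j ∷ av) , p }) (words n (suc m)))
      (count-avoiding n v (λ w → P? (punchIn v j ∷ w)))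

module Occurrences where

  open import Defs using (words; Increasing; increasing?)
  open Counting
  open import Data.Nat.Base as ℕ using (ℕ; zero; suc; _+_; _*_; z≤n; s≤s; s≤s⁻¹)
  import Data.Nat.Properties as ℕ
  open import Data.Nat.Combinatorics using (_C_; nCk+nC[k+1]≡[n+1]C[k+1])
  open import Data.Fin.Base as Fin using (Fin; zero; suc; punchIn; toℕ; _<_)
  import Data.Fin.Properties as Fin
  open import Data.Vec.Base using (Vec; _∷_; lookup; map)
  open import Data.Vec.Properties using (lookup-map; map-∘)
  open import Data.Vec.Relation.Unary.All using (All; _∷_; all?)
  open import Data.Vec.Relation.Unary.All.Properties using (lookup⁻; map⁺; map⁻)
  open import Data.Product.Base using (_×_; _,_; proj₁; proj₂)
  open import Function.Base using (_∘_)
  open import Relation.Nullary using (Dec; yes; no; ¬?)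
  open import Relation.Nullary.Decidable using (_×-dec_)
  open import Relation.Unary using (Pred; Decidable)
  open import Relation.Binary.PropositionalEquality
    using (_≡_; _≢_; refl; cong; cong₂; trans; sym; subst; subst₂; module ≡-Reasoning)
  open import Algebra.Properties.CommutativeMonoid.Sum ℕ.+-0-commutativeMonoid using (sum-syntax; sum-cong-≗)

  toℕ-punchIn-< : ∀ {n} (u : Fin (suc n)) (x : Fin n) → toℕ x ℕ.< toℕ u → toℕ (punchIn u x) ≡ toℕ x
  toℕ-punchIn-< (suc u) zero    _         = refl
  toℕ-punchIn-< (suc u) (suc x) (s≤s x<u) = cong suc (toℕ-punchIn-< u x x<u)

  toℕ-punchIn-≥ : ∀ {n} (u : Fin (suc n)) (x : Fin n) → toℕ u ℕ.≤ toℕ x → toℕ (punchIn u x) ≡ suc (toℕ x)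
  toℕ-punchIn-≥ zero    x       _         = refl
  toℕ-punchIn-≥ (suc u) (suc x) (s≤s u≤x) = cong suc (toℕ-punchIn-≥ u x u≤x)

  <punchIn : ∀ {n} (u : Fin (suc n)) (x : Fin n) → toℕ u ℕ.≤ toℕ x → u < punchIn u x
  <punchIn zero    x       _         = s≤s z≤n
  <punchIn (suc u) (suc x) (s≤s u≤x) = s≤s (<punchIn u x u≤x)

  <punchIn⁻¹ : ∀ {n} (u : Fin (suc n)) (x : Fin n) → u < punchIn u x → toℕ u ℕ.≤ toℕ x
  <punchIn⁻¹ zero    x       _         = z≤n
  <punchIn⁻¹ (suc u) (suc x) (s≤s u<x) = s≤s (<punchIn⁻¹ u x u<x)

  punchIn-mono-< : ∀ {n} (u : Fin (suc n)) {x y : Fin n} → x < y → punchIn u x < punchIn u y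
  punchIn-mono-< u {x} {y} x<y =
    Fin.≤∧≢⇒< (Fin.punchIn-mono-≤ u x y (ℕ.<⇒≤ x<y)) (Fin.<⇒≢ x<y ∘ Fin.punchIn-injective u x y)

  punchIn-cancel-< : ∀ {n} (u : Fin (suc n)) {x y : Fin n} → punchIn u x < punchIn u y → x < y
  punchIn-cancel-< u {x} {y} p = Fin.≤∧≢⇒< (Fin.punchIn-cancel-≤ u x y (ℕ.<⇒≤ p)) (Fin.<⇒≢ p ∘ cong (punchIn u))

  private
    variable
      k m n : ℕ

  Increasing-∷⁻ : ∀ {x} {v : Vec (Fin m) k} → Increasing (x ∷ v) → (∀ b → x < lookup v b) × Increasing v
  Increasing-∷⁻ inc = (λ b → inc zero (suc b) (s≤s z≤n)) , (λ b b′ b<b′ → inc (suc b) (suc b′) (s≤s b<b′))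

  Increasing-∷⁺ : ∀ {x} {v : Vec (Fin m) k} → (∀ b → x < lookup v b) → Increasing v → Increasing (x ∷ v)
  Increasing-∷⁺ x<v inc zero    (suc b′) _         = x<v b′
  Increasing-∷⁺ x<v inc (suc b) (suc b′) (s≤s b<b′) = inc b b′ b<b′

  Increasing-map⁺ : ∀ {m′} (g : Fin m → Fin m′) (v : Vec (Fin m) k) → (∀ {x y} → x < y → g x < g y) →
                    Increasing v → Increasing (map g v)
  Increasing-map⁺ g v mono inc b b′ b<b′ = subst₂ _<_ (sym (lookup-map b g v)) (sym (lookup-map b′ g v)) (mono (inc b b′ b<b′))

  Increasing-map⁻ : ∀ {m′} (g : Fin m → Fin m′) (v : Vec (Fin m) k) → (∀ {x y} → g x < g y → x < y) →
                    Increasing (map g v) → Increasing v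
  Increasing-map⁻ g v cancel inc b b′ b<b′ = cancel (subst₂ _<_ (lookup-map b g v) (lookup-map b′ g v) (inc b b′ b<b′))

  Increasing-suc : (ι : Vec (Fin n) k) → Increasing ι → Increasing (map suc ι)
  Increasing-suc ι = Increasing-map⁺ suc ι s≤s

  Increasing-suc⁻ : (ι : Vec (Fin n) k) → Increasing (map suc ι) → Increasing ι
  Increasing-suc⁻ ι = Increasing-map⁻ suc ι s≤s⁻¹

  Increasing-0∷suc : (ι : Vec (Fin n) k) → Increasing ι → Increasing (zero ∷ map suc ι)
  Increasing-0∷suc {n} ι inc = Increasing-∷⁺ (λ b → subst (Fin.zero {n} <_) (sym (lookup-map b suc ι)) (s≤s z≤n)) (Increasing-suc ι inc)

  -- Index vectors i ∷ ι′ that are increasing never use index 0 in ι′, so they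
  -- can be counted as i ∷ map suc ι.
  count-increasing-∷ : ∀ {p} {P : Pred (Vec (Fin (suc n)) (suc k)) p} (P? : Decidable P) →
    (∀ {ι} → P ι → Increasing ι) → ∀ i →
    count (λ ι′ → P? (i ∷ ι′)) (words k (suc n)) ≡ count (λ ι → P? (i ∷ map suc ι)) (words k n)
  count-increasing-∷ {n} {k} P? inc i = trans
    (count-cong (λ ι′ → P? (i ∷ ι′)) (λ ι′ → all? (λ x → ¬? (x Fin.≟ zero)) ι′ ×-dec P? (i ∷ ι′))
      (λ p → lookup⁻ (λ b e → ℕ.n≮0 (subst (λ z → toℕ i ℕ.< toℕ z) e (proj₁ (Increasing-∷⁻ (inc p)) b))) , p) proj₂
      (words k (suc n)))
    (count-avoiding k zero (λ ι′ → P? (i ∷ ι′)))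

  -- IsOcc and occ of Defs, for words of length n over Fin m.
  IsOccurrence : ∀ k → Vec (Fin m) n → Vec (Fin n) k → Set
  IsOccurrence k π ι = Increasing ι × Increasing (map (lookup π) ι)

  isOccurrence? : ∀ k (π : Vec (Fin m) n) (ι : Vec (Fin n) k) → Dec (IsOccurrence k π ι)
  isOccurrence? k π ι = increasing? ι ×-dec increasing? (map (lookup π) ι)

  occurrences : ∀ k → Vec (Fin m) n → ℕ
  occurrences {n = n} k π = count (isOccurrence? k π) (words k n)

  AllAbove : Fin m → Vec (Fin m) n → Vec (Fin n) k → Set
  AllAbove v π ι = ∀ b → v < lookup (map (lookup π) ι) b

  allAbove? : (v : Fin m) (π : Vec (Fin m) n) (ι : Vec (Fin n) k) → Dec (AllAbove v π ι)
  allAbove? v π ι = Fin.all? λ b → v Fin.<? lookup (map (lookup π) ι) b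

  private
    values-suc : ∀ (v : Fin m) (τ : Vec (Fin m) n) (ι : Vec (Fin n) k) →
                 map (lookup (v ∷ τ)) (map suc ι) ≡ map (lookup τ) ι
    values-suc v τ ι = sym (map-∘ (lookup (v ∷ τ)) suc ι)

    IsOccurrence-suc⁺ : ∀ {v : Fin m} {τ : Vec (Fin m) n} (ι : Vec (Fin n) k) →
                        IsOccurrence k τ ι → IsOccurrence k (v ∷ τ) (map suc ι)
    IsOccurrence-suc⁺ {v = v} {τ} ι (inc , inc-vals) =
      Increasing-suc ι inc , subst Increasing (sym (values-suc v τ ι)) inc-vals

    IsOccurrence-suc⁻ : ∀ {v : Fin m} {τ : Vec (Fin m) n} (ι : Vec (Fin n) k) →
                        IsOccurrence k (v ∷ τ) (map suc ι) → IsOccurrence k τ ι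
    IsOccurrence-suc⁻ {v = v} {τ} ι (inc , inc-vals) =
      Increasing-suc⁻ ι inc , subst Increasing (values-suc v τ ι) inc-vals

  -- An occurrence of 12…(j+1) in v ∷ τ either avoids the first position or
  -- consists of it followed by an occurrence of 12…j in τ with all values above v.
  occurrences-∷ : ∀ j (v : Fin m) (τ : Vec (Fin m) n) →
    occurrences (suc j) (v ∷ τ) ≡ occurrences (suc j) τ + count (λ ι → isOccurrence? j τ ι ×-dec allAbove? v τ ι) (words j n)
  occurrences-∷ {n = n} j v τ = begin
    occurrences (suc j) (v ∷ τ)                      ≡⟨ count-words-suc (isOccurrence? (suc j) (v ∷ τ)) ⟩
    ∑[ i < suc n ] H i                               ≡⟨ cong₂ _+_ H-zero (sum-cong-≗ H-suc) ⟩
    above + ∑[ i < n ] count (λ ι → isOccurrence? (suc j) τ (i ∷ ι)) (words j n)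
                                                     ≡⟨ cong (above +_) (sym (count-words-suc (isOccurrence? (suc j) τ))) ⟩
    above + occurrences (suc j) τ                    ≡⟨ ℕ.+-comm above _ ⟩
    occurrences (suc j) τ + above                    ∎
    where
    open ≡-Reasoning
    above = count (λ ι → isOccurrence? j τ ι ×-dec allAbove? v τ ι) (words j n)
    H : Fin (suc n) → ℕ
    H i = count (λ ι′ → isOccurrence? (suc j) (v ∷ τ) (i ∷ ι′)) (words j (suc n))
    H≡ : ∀ i → H i ≡ count (λ ι → isOccurrence? (suc j) (v ∷ τ) (i ∷ map suc ι)) (words j n)
    H≡ = count-increasing-∷ (isOccurrence? (suc j) (v ∷ τ)) proj₁
    H-zero : H zero ≡ above
    H-zero = trans (H≡ zero) (count-cong _ _
      (λ { {ι} (inc , inc-vals) →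
             let v<vals , inc-vals′ = Increasing-∷⁻ (subst (λ u → Increasing (v ∷ u)) (values-suc v τ ι) inc-vals)
             in (Increasing-suc⁻ ι (proj₂ (Increasing-∷⁻ inc)) , inc-vals′) , v<vals })
      (λ { {ι} ((inc , inc-vals) , v<vals) →
             Increasing-0∷suc ι inc
           , subst (λ u → Increasing (v ∷ u)) (sym (values-suc v τ ι)) (Increasing-∷⁺ v<vals inc-vals) })
      (words j n))
    H-suc : ∀ i → H (suc i) ≡ count (λ ι → isOccurrence? (suc j) τ (i ∷ ι)) (words j n)
    H-suc i = trans (H≡ (suc i)) (count-cong _ _ (IsOccurrence-suc⁻ (i ∷ _)) (IsOccurrence-suc⁺ (i ∷ _)) (words j n))

  size : ∀ {p} {S : Pred (Fin n) p} → Decidable S → ℕ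
  size {n} S? = ∑[ i < n ] indicator (S? i)

  -- An increasing index vector inside S is a j-element subset of S.
  count-increasing-within : ∀ n j {p} {S : Pred (Fin n) p} (S? : Decidable S) →
    count (λ ι → increasing? ι ×-dec all? S? ι) (words j n) ≡ size S? C j
  count-increasing-within zero    zero    S? = refl
  count-increasing-within zero    (suc j) S? = refl
  count-increasing-within (suc n) zero    S? = refl
  count-increasing-within (suc n) (suc j) {S = S} S? = begin
    count Q (words (suc j) (suc n))                                 ≡⟨ count-words-suc {n = j} Q ⟩
    ∑[ i < suc n ] count (λ ι′ → Q (i ∷ ι′)) (words j (suc n))      ≡⟨ sum-cong-≗ (count-increasing-∷ {k = j} Q proj₁) ⟩
    ∑[ i < suc n ] count (λ ι → Q (i ∷ map suc ι)) (words j n)      ≡⟨ cong₂ _+_ first (sum-cong-≗ rest) ⟩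
    indicator (S? zero) * (s C j) + ∑[ i < n ] count (λ ι → Q′ (i ∷ ι)) (words j n)
                                                                    ≡⟨ cong (indicator (S? zero) * (s C j) +_) (sym (count-words-suc {n = j} Q′)) ⟩
    indicator (S? zero) * (s C j) + count Q′ (words (suc j) n)      ≡⟨ cong (indicator (S? zero) * (s C j) +_) (count-increasing-within n (suc j) (S? ∘ suc)) ⟩
    indicator (S? zero) * (s C j) + s C suc j                       ≡⟨ pascal (S? zero) ⟩
    (indicator (S? zero) + s) C suc j                               ∎
    where
    open ≡-Reasoning
    Q : ∀ {k} (ι : Vec (Fin (suc n)) k) → Dec (Increasing ι × All S ι)
    Q ι = increasing? ι ×-dec all? S? ι
    Q′ : ∀ {k} (ι : Vec (Fin n) k) → Dec (Increasing ι × All (S ∘ suc) ι)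
    Q′ ι = increasing? ι ×-dec all? (S? ∘ suc) ι
    s = size (S? ∘ suc)
    rest : ∀ i → count (λ ι → Q (suc i ∷ map suc ι)) (words j n) ≡ count (λ ι → Q′ (i ∷ ι)) (words j n)
    rest i = count-cong _ _ (λ (inc , all) → Increasing-suc⁻ (i ∷ _) inc , map⁻ all)
                            (λ (inc , all) → Increasing-suc (i ∷ _) inc , map⁺ all) (words j n)
    first : count (λ ι → Q (zero ∷ map suc ι)) (words j n) ≡ indicator (S? zero) * (s C j)
    first with S? zero
    ... | yes s₀ = trans (count-cong _ Q′ (λ { {ι} (inc , _ ∷ all) → Increasing-suc⁻ ι (proj₂ (Increasing-∷⁻ inc)) , map⁻ all })
                            (λ {ι} (inc , all) → Increasing-0∷suc ι inc , s₀ ∷ map⁺ all) (words j n))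
                         (trans (count-increasing-within n j (S? ∘ suc)) (sym (ℕ.+-identityʳ _)))
    ... | no ¬s₀ = count-none _ (λ { _ (_ , s₀ ∷ _) → ¬s₀ s₀ }) (words j n)
    pascal : (d : Dec (S zero)) → indicator d * (s C j) + s C suc j ≡ (indicator d + s) C suc j
    pascal (yes _) = trans (cong (_+ s C suc j) (ℕ.+-identityʳ _)) (nCk+nC[k+1]≡[n+1]C[k+1] s j)
    pascal (no _)  = refl

module Permutations where

  open import Defs using (words; Increasing; increasing?)
  open Counting
  open Occurrences
  open import Data.Nat.Base as ℕ using (ℕ; zero; suc; _+_; _∸_; z≤n; s≤s; s≤s⁻¹)
  import Data.Nat.Properties as ℕ
  open import Data.Nat.Combinatorics using (_C_)
  open import Data.Fin.Base as Fin using (Fin; zero; suc; punchIn; punchOut; toℕ; _<_)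
  import Data.Fin.Properties as Fin
  open import Data.Vec.Base using (Vec; []; _∷_; lookup; map; tabulate)
  open import Data.Vec.Properties using (lookup-map; map-∘; lookup∘tabulate)
  open import Data.Vec.Relation.Unary.All using (All; []; _∷_; all?)
  open import Data.Vec.Relation.Unary.All.Properties using (lookup⁺; lookup⁻)
  open import Data.Product.Base using (_×_; _,_; proj₁; proj₂; ∃-syntax)
  open import Function.Base using (_∘_)
  open import Function.Bundles using (_⇔_; mk⇔; Equivalence)
  open import Function.Construct.Identity using (⇔-id)
  open import Relation.Nullary using (¬_; Dec; yes; no; ¬?; contradiction)
  open import Relation.Nullary.Decidable using (_×-dec_)
  open import Relation.Binary.PropositionalEquality
    using (_≡_; _≢_; refl; cong; trans; sym; subst; subst₂; module ≡-Reasoning)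
  open import Algebra.Properties.CommutativeMonoid.Sum ℕ.+-0-commutativeMonoid using (sum-cong-≗)

  private
    variable
      j k m n : ℕ

  -- IsPerm and Contains132 of Defs, for words of length n over Fin m.
  Inj : Vec (Fin m) n → Set
  Inj {n = n} π = ∀ (i j : Fin n) → lookup π i ≡ lookup π j → i ≡ j

  Has132 : Vec (Fin m) n → Set
  Has132 {n = n} π = ∃[ i ] ∃[ j ] ∃[ l ]
    ((i < j × j < l) × (lookup π i < lookup π l × lookup π l < lookup π j))

  -- Every entry of σ that is at least a is a left-to-right maximum.
  Records≥ : ℕ → Vec (Fin m) n → Set
  Records≥ a σ = ¬ (∃[ j ] ∃[ l ] (j < l × (a ℕ.≤ toℕ (lookup σ l) × lookup σ l < lookup σ j)))

  records≥? : ∀ a (σ : Vec (Fin m) n) → Dec (Records≥ a σ)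
  records≥? a σ = ¬? (Fin.any? λ j → Fin.any? λ l →
    (j Fin.<? l) ×-dec ((a ℕ.≤? toℕ (lookup σ l)) ×-dec (lookup σ l Fin.<? lookup σ j)))

  Inj-∷⁻ : ∀ {v : Fin m} {τ : Vec (Fin m) n} → Inj (v ∷ τ) → All (_≢ v) τ × Inj τ
  Inj-∷⁻ inj = lookup⁻ (λ i e → Fin.0≢1+n (sym (inj (suc i) zero e))) , (λ i j e → Fin.suc-injective (inj (suc i) (suc j) e))

  Inj-∷⁺ : ∀ {v : Fin m} {τ : Vec (Fin m) n} → All (_≢ v) τ → Inj τ → Inj (v ∷ τ)
  Inj-∷⁺ av inj zero    zero    e = refl
  Inj-∷⁺ av inj zero    (suc j) e = contradiction (sym e) (lookup⁺ av j)
  Inj-∷⁺ av inj (suc i) zero    e = contradiction e (lookup⁺ av i)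
  Inj-∷⁺ av inj (suc i) (suc j) e = cong suc (inj i j e)

  Inj-punchIn⁻ : ∀ (v : Fin (suc m)) (σ : Vec (Fin m) n) → Inj (map (punchIn v) σ) → Inj σ
  Inj-punchIn⁻ v σ inj i j e = inj i j (trans (lookup-map i (punchIn v) σ) (trans (cong (punchIn v) e) (sym (lookup-map j (punchIn v) σ))))

  Inj-punchIn⁺ : ∀ (v : Fin (suc m)) (σ : Vec (Fin m) n) → Inj σ → Inj (map (punchIn v) σ)
  Inj-punchIn⁺ v σ inj i j e =
    inj i j (Fin.punchIn-injective v _ _ (trans (sym (lookup-map i (punchIn v) σ)) (trans e (lookup-map j (punchIn v) σ))))

  All≢-punchIn : ∀ (v : Fin (suc m)) (σ : Vec (Fin m) n) → All (_≢ v) (map (punchIn v) σ)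
  All≢-punchIn v σ = lookup⁻ λ i e → Fin.punchInᵢ≢i v (lookup σ i) (trans (sym (lookup-map i (punchIn v) σ)) e)

  AllAtLeast : ℕ → Vec (Fin m) n → Vec (Fin n) k → Set
  AllAtLeast a σ ι = ∀ b → a ℕ.≤ toℕ (lookup (map (lookup σ) ι) b)

  allAtLeast? : ∀ a (σ : Vec (Fin m) n) (ι : Vec (Fin n) k) → Dec (AllAtLeast a σ ι)
  allAtLeast? a σ ι = Fin.all? λ b → a ℕ.≤? toℕ (lookup (map (lookup σ) ι) b)

  module _ (v : Fin (suc m)) (σ : Vec (Fin m) n) where

    private
      π = map (punchIn v) σ

      π-mono : ∀ x y → lookup σ x < lookup σ y → lookup π x < lookup π y
      π-mono x y = subst₂ _<_ (sym (lookup-map x (punchIn v) σ)) (sym (lookup-map y (punchIn v) σ)) ∘ punchIn-mono-< v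

      π-cancel : ∀ x y → lookup π x < lookup π y → lookup σ x < lookup σ y
      π-cancel x y = punchIn-cancel-< v ∘ subst₂ _<_ (lookup-map x (punchIn v) σ) (lookup-map y (punchIn v) σ)

      v<π : ∀ x → toℕ v ℕ.≤ toℕ (lookup σ x) → v < lookup π x
      v<π x = subst (v <_) (sym (lookup-map x (punchIn v) σ)) ∘ <punchIn v (lookup σ x)

      v<π⁻¹ : ∀ x → v < lookup π x → toℕ v ℕ.≤ toℕ (lookup σ x)
      v<π⁻¹ x = <punchIn⁻¹ v (lookup σ x) ∘ subst (v <_) (lookup-map x (punchIn v) σ)

    avoids132-∷⁻ : ¬ Has132 (v ∷ π) → ¬ Has132 σ × Records≥ (toℕ v) σ
    avoids132-∷⁻ no132 =
      (λ (i , j , l , (i<j , j<l) , (σi<σl , σl<σj)) →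
         no132 (suc i , suc j , suc l , (s≤s i<j , s≤s j<l) , (π-mono i l σi<σl , π-mono l j σl<σj))) ,
      (λ (j , l , j<l , (v≤σl , σl<σj)) →
         no132 (zero , suc j , suc l , (s≤s z≤n , s≤s j<l) , (v<π l v≤σl , π-mono l j σl<σj)))

    avoids132-∷⁺ : ¬ Has132 σ → Records≥ (toℕ v) σ → ¬ Has132 (v ∷ π)
    avoids132-∷⁺ no132 records (zero  , suc j , suc l , (_ , s≤s j<l) , (v<πl , πl<πj)) =
      records (j , l , j<l , (v<π⁻¹ l v<πl , π-cancel l j πl<πj))
    avoids132-∷⁺ no132 records (suc i , suc j , suc l , (s≤s i<j , s≤s j<l) , (πi<πl , πl<πj)) =
      no132 (i , j , l , (i<j , j<l) , (π-cancel i l πi<πl , π-cancel l j πl<πj))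
    avoids132-∷⁺ no132 records (zero  , zero  , _ , (() , _) , _)
    avoids132-∷⁺ no132 records (_     , suc j , zero , (_ , ()) , _)
    avoids132-∷⁺ no132 records (suc i , zero  , _ , (() , _) , _)

    values-punchIn : ∀ (ι : Vec (Fin n) k) → map (lookup π) ι ≡ map (punchIn v) (map (lookup σ) ι)
    values-punchIn ι = trans (map-cong (λ x → lookup-map x (punchIn v) σ) ι) (map-∘ (punchIn v) (lookup σ) ι)
      where open import Data.Vec.Properties using (map-cong)

    private
      Increasing-values⁻ : ∀ (ι : Vec (Fin n) k) → Increasing (map (lookup π) ι) → Increasing (map (lookup σ) ι)
      Increasing-values⁻ ι = Increasing-map⁻ (punchIn v) (map (lookup σ) ι) (punchIn-cancel-< v) ∘ subst Increasing (values-punchIn ι)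

      Increasing-values⁺ : ∀ (ι : Vec (Fin n) k) → Increasing (map (lookup σ) ι) → Increasing (map (lookup π) ι)
      Increasing-values⁺ ι = subst Increasing (sym (values-punchIn ι)) ∘ Increasing-map⁺ (punchIn v) (map (lookup σ) ι) (punchIn-mono-< v)

      value-punchIn : ∀ (ι : Vec (Fin n) k) b → lookup (map (lookup π) ι) b ≡ punchIn v (lookup (map (lookup σ) ι) b)
      value-punchIn ι b = trans (cong (λ u → lookup u b) (values-punchIn ι)) (lookup-map b (punchIn v) (map (lookup σ) ι))

    occurrences-punchIn : ∀ j → occurrences j π ≡ occurrences j σ
    occurrences-punchIn j = count-cong _ _
      (λ {ι} (inc , inc-vals) → inc , Increasing-values⁻ ι inc-vals)
      (λ {ι} (inc , inc-vals) → inc , Increasing-values⁺ ι inc-vals) (words j n)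

    count-above-punchIn : ∀ j →
      count (λ ι → isOccurrence? j π ι ×-dec allAbove? v π ι) (words j n) ≡
      count (λ ι → isOccurrence? j σ ι ×-dec allAtLeast? (toℕ v) σ ι) (words j n)
    count-above-punchIn j = count-cong _ _
      (λ {ι} ((inc , inc-vals) , above) →
         (inc , Increasing-values⁻ ι inc-vals) , λ b → <punchIn⁻¹ v _ (subst (v <_) (value-punchIn ι b) (above b)))
      (λ {ι} ((inc , inc-vals) , atLeast) →
         (inc , Increasing-values⁺ ι inc-vals) , λ b → subst (v <_) (sym (value-punchIn ι b)) (<punchIn v _ (atLeast b)))
      (words j n)

  unpunch : ∀ (u : Fin (suc m)) (τ : Vec (Fin (suc m)) n) → All (_≢ u) τ → Inj τ →
            ∃[ ρ ] (Inj ρ × (∀ l → lookup τ l ≡ punchIn u (lookup ρ l)))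
  unpunch {m} u τ av inj = ρ , ρ-inj , τ≡
    where
    τ≢u : ∀ l → u ≢ lookup τ l
    τ≢u l = lookup⁺ av l ∘ sym
    ρ = tabulate λ l → punchOut (τ≢u l)
    τ≡ : ∀ l → lookup τ l ≡ punchIn u (lookup ρ l)
    τ≡ l = sym (trans (cong (punchIn u) (lookup∘tabulate _ l)) (Fin.punchIn-punchOut (τ≢u l)))
    ρ-inj : Inj ρ
    ρ-inj i j e = inj i j (Fin.punchOut-injective (τ≢u i) (τ≢u j)
      (trans (sym (lookup∘tabulate _ i)) (trans e (lookup∘tabulate _ j))))

  ≤-punchIn-below : ∀ {a} (u : Fin (suc m)) x → a ℕ.≤ toℕ u → a ℕ.≤ toℕ (punchIn u x) ⇔ a ℕ.≤ toℕ x
  ≤-punchIn-below {a = a} u x a≤u with toℕ x ℕ.<? toℕ u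
  ... | yes x<u = subst (λ z → a ℕ.≤ z ⇔ _) (sym (toℕ-punchIn-< u x x<u)) (⇔-id _)
  ... | no x≮u  = mk⇔ (λ _ → a≤x) (λ _ → subst (a ℕ.≤_) (sym (toℕ-punchIn-≥ u x u≤x)) (ℕ.m≤n⇒m≤1+n a≤x))
    where
    u≤x = ℕ.≮⇒≥ x≮u
    a≤x = ℕ.≤-trans a≤u u≤x

  ≤-punchIn-above : ∀ {a} (u : Fin (suc m)) x → toℕ u ℕ.≤ a → suc a ℕ.≤ toℕ (punchIn u x) ⇔ a ℕ.≤ toℕ x
  ≤-punchIn-above {a = a} u x u≤a with toℕ x ℕ.<? toℕ u
  ... | yes x<u = mk⇔ (λ a<πx → contradiction (subst (a ℕ.<_) (toℕ-punchIn-< u x x<u) a<πx) (ℕ.<-asym x<a))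
                      (λ a≤x → contradiction a≤x (ℕ.<⇒≱ x<a))
    where
    x<a : toℕ x ℕ.< a
    x<a = ℕ.<-≤-trans x<u u≤a
  ... | no x≮u  = subst (λ z → suc a ℕ.≤ z ⇔ _) (sym (toℕ-punchIn-≥ u x (ℕ.≮⇒≥ x≮u))) (mk⇔ s≤s⁻¹ s≤s)

  size-≥ : ∀ n (σ : Vec (Fin n) n) → Inj σ → ∀ a → size (λ l → a ℕ.≤? toℕ (lookup σ l)) ≡ n ∸ a
  size-≥ zero    []      inj a = sym (ℕ.0∸n≡0 a)
  size-≥ (suc n) (u ∷ τ) inj a with unpunch u τ (proj₁ (Inj-∷⁻ inj)) (proj₂ (Inj-∷⁻ inj)) | a ℕ.≤? toℕ u
  ... | ρ , ρ-inj , τ≡ | yes a≤u = trans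
    (cong suc (trans (sum-cong-≗ λ l → indicator-cong (Equivalence.to (equiv l)) (Equivalence.from (equiv l)) _ _) (size-≥ n ρ ρ-inj a)))
    (sym (ℕ.+-∸-assoc 1 (ℕ.≤-trans a≤u (s≤s⁻¹ (Fin.toℕ<n u)))))
    where
    equiv : ∀ l → a ℕ.≤ toℕ (lookup τ l) ⇔ a ℕ.≤ toℕ (lookup ρ l)
    equiv l = subst (λ z → _ ℕ.≤ toℕ z ⇔ _) (sym (τ≡ l)) (≤-punchIn-below u (lookup ρ l) a≤u)
  ... | ρ , ρ-inj , τ≡ | no a≰u with a
  ...   | zero   = contradiction z≤n a≰u
  ...   | suc a′ = trans (sum-cong-≗ λ l → indicator-cong (Equivalence.to (equiv l)) (Equivalence.from (equiv l)) _ _) (size-≥ n ρ ρ-inj a′)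
    where
    equiv : ∀ l → suc a′ ℕ.≤ toℕ (lookup τ l) ⇔ a′ ℕ.≤ toℕ (lookup ρ l)
    equiv l = subst (λ z → _ ℕ.≤ toℕ z ⇔ _) (sym (τ≡ l)) (≤-punchIn-above u (lookup ρ l) (s≤s⁻¹ (ℕ.≰⇒> a≰u)))

  head≤⇒Records≥ : ∀ (u : Fin (suc n)) (τ : Vec (Fin (suc n)) n) → Inj (u ∷ τ) → ¬ Has132 (u ∷ τ) →
                   ∀ a → toℕ u ℕ.≤ a → Records≥ a (u ∷ τ)
  head≤⇒Records≥ u τ inj no132 a u≤a (zero , l , _ , (a≤πl , πl<u)) =
    ℕ.<-irrefl refl (ℕ.<-≤-trans πl<u (ℕ.≤-trans u≤a a≤πl))
  head≤⇒Records≥ u τ inj no132 a u≤a (suc j , suc l , j<l , (a≤τl , τl<τj)) =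
    no132 (zero , suc j , suc l , (s≤s z≤n , j<l) , (u<τl , τl<τj))
    where
    u<τl : u < lookup τ l
    u<τl = Fin.≤∧≢⇒< (ℕ.≤-trans u≤a a≤τl) (Fin.0≢1+n ∘ inj zero (suc l))
  head≤⇒Records≥ u τ inj no132 a u≤a (suc j , zero , () , _)

  Records≥⇒head≤ : ∀ (u : Fin (suc n)) (τ : Vec (Fin (suc n)) n) → Inj (u ∷ τ) →
                   ∀ a → Records≥ a (u ∷ τ) → toℕ u ℕ.≤ a
  Records≥⇒head≤ {n} u τ inj a records with toℕ u ℕ.≤? a
  ... | yes u≤a = u≤a
  -- Otherwise no entry equals a, so as many entries are at least a as are at least a + 1.
  ... | no u≰a  = contradiction (begin
        suc (n ∸ a)                       ≡⟨ ℕ.+-∸-assoc 1 a≤n ⟨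
        suc n ∸ a                         ≡⟨ size-≥ (suc n) (u ∷ τ) inj a ⟨
        size (λ l → a ℕ.≤? toℕ (π l))     ≡⟨ sum-cong-≗ (λ l → indicator-cong (skip-a l) ℕ.<⇒≤ (a ℕ.≤? toℕ (π l)) (suc a ℕ.≤? toℕ (π l))) ⟩
        size (λ l → suc a ℕ.≤? toℕ (π l)) ≡⟨ size-≥ (suc n) (u ∷ τ) inj (suc a) ⟩
        n ∸ a                             ∎) ℕ.1+n≢n
    where
    open ≡-Reasoning
    π = lookup (u ∷ τ)
    a<u : a ℕ.< toℕ u
    a<u = ℕ.≰⇒> u≰a
    a≤n : a ℕ.≤ n
    a≤n = s≤s⁻¹ (ℕ.<-trans a<u (Fin.toℕ<n u))
    π≢a : ∀ l → toℕ (π l) ≢ a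
    π≢a zero    e = ℕ.<-irrefl (sym e) a<u
    π≢a (suc l) e = records (zero , suc l , s≤s z≤n , (ℕ.≤-reflexive (sym e) , subst (ℕ._< toℕ u) (sym e) a<u))
    skip-a : ∀ l → a ℕ.≤ toℕ (π l) → suc a ℕ.≤ toℕ (π l)
    skip-a l a≤πl = ℕ.≤∧≢⇒< a≤πl (π≢a l ∘ sym)

  -- When the entries ≥ a are left-to-right maxima, every j of them form an occurrence of 12…j.
  count-atLeast : ∀ (σ : Vec (Fin n) n) → Inj σ → ∀ a → Records≥ a σ → ∀ j →
    count (λ ι → isOccurrence? j σ ι ×-dec allAtLeast? a σ ι) (words j n) ≡ (n ∸ a) C j
  count-atLeast {n} σ inj a records j = begin
    count (λ ι → isOccurrence? j σ ι ×-dec allAtLeast? a σ ι) (words j n)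
      ≡⟨ count-cong _ (λ ι → increasing? ι ×-dec all? S? ι) (λ {ι} ((inc , _) , atLeast) → inc , lookup⁻ (atLeast→S ι atLeast))
                                                           (λ {ι} (inc , allS) → (inc , inc-vals ι inc allS) , S→atLeast ι allS) (words j n) ⟩
    count (λ ι → increasing? ι ×-dec all? S? ι) (words j n)
      ≡⟨ count-increasing-within n j S? ⟩
    size S? C j
      ≡⟨ cong (_C j) (size-≥ n σ inj a) ⟩
    (n ∸ a) C j ∎
    where
    open ≡-Reasoning
    S? = λ l → a ℕ.≤? toℕ (lookup σ l)
    atLeast→S : ∀ {k} (ι : Vec (Fin n) k) → AllAtLeast a σ ι → ∀ b → a ℕ.≤ toℕ (lookup σ (lookup ι b))
    atLeast→S ι atLeast b = subst (λ z → a ℕ.≤ toℕ z) (lookup-map b (lookup σ) ι) (atLeast b)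
    S→atLeast : ∀ {k} (ι : Vec (Fin n) k) → All (λ l → a ℕ.≤ toℕ (lookup σ l)) ι → AllAtLeast a σ ι
    S→atLeast ι allS b = subst (λ z → a ℕ.≤ toℕ z) (sym (lookup-map b (lookup σ) ι)) (lookup⁺ allS b)
    inc-vals : ∀ {k} (ι : Vec (Fin n) k) → Increasing ι → All (λ l → a ℕ.≤ toℕ (lookup σ l)) ι → Increasing (map (lookup σ) ι)
    inc-vals ι inc allS b b′ b<b′ = subst₂ _<_ (sym (lookup-map b (lookup σ) ι)) (sym (lookup-map b′ (lookup σ) ι))
      (Fin.≤∧≢⇒< (ℕ.≮⇒≥ λ σb′<σb → records (lookup ι b , lookup ι b′ , inc b b′ b<b′ , (lookup⁺ allS b′ , σb′<σb)))
                  (λ e → Fin.<⇒≢ (inc b b′ b<b′) (inj _ _ e)))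

module FirstLetter (k′ : ℕ) where

  open import Defs using (words; f; IsPerm; isPerm?; Contains132; contains132?; occ)
  open Counting
  open Occurrences
  open Permutations
  open import Data.Nat.Base as ℕ using (zero; suc; _+_; _*_; _∸_; _≤_)
  import Data.Nat.Properties as ℕ
  open import Data.Nat.Combinatorics using (_C_)
  open import Data.Fin.Base using (Fin; zero; suc; punchIn; toℕ)
  import Data.Fin.Properties as Fin
  open import Data.Vec.Base using (Vec; []; _∷_; map)
  open import Data.Vec.Relation.Unary.All using (all?)
  open import Data.Product.Base using (_×_; _,_; proj₁; proj₂)
  open import Relation.Nullary using (¬_; Dec; ¬?)
  open import Relation.Nullary.Decidable using (_×-dec_)
  open import Relation.Binary.PropositionalEquality using (_≡_; refl; cong; cong₂; trans; sym; subst; module ≡-Reasoning)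
  open import Function.Base using (_∘′_)
  open import Algebra.Properties.CommutativeMonoid.Sum ℕ.+-0-commutativeMonoid using (sum-syntax; sum-cong-≗)

  k : ℕ
  k = suc k′

  Good : ∀ {n} → ℕ → Vec (Fin n) n → Set
  Good r π = IsPerm π × (¬ Contains132 π × occ k π ≡ r)

  good? : ∀ {n} r (π : Vec (Fin n) n) → Dec (Good r π)
  good? r π = isPerm? π ×-dec (¬? (contains132? π) ×-dec (occ k π ℕ.≟ r))

  f-zero : ∀ r → f k 0 r ≡ indicator (0 ℕ.≟ r)
  f-zero r = trans (count-[_] (good? r) []) (indicator-cong (proj₂ ∘′ proj₂) (λ 0≡r → (λ ()) , (λ { (() , _) }) , 0≡r) _ _)

  -- Prepending v to the relabelled σ adds one occurrence for each k′ entries of σ above v.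
  occ-∷-punchIn : ∀ {n} (v : Fin (suc n)) (σ : Vec (Fin n) n) → Inj σ → Records≥ (toℕ v) σ →
                  occ k (v ∷ map (punchIn v) σ) ≡ occ k σ + (n ∸ toℕ v) C k′
  occ-∷-punchIn {n} v σ inj records = begin
    occurrences k (v ∷ map (punchIn v) σ)
      ≡⟨ occurrences-∷ k′ v (map (punchIn v) σ) ⟩
    occurrences k (map (punchIn v) σ) + count (λ ι → isOccurrence? k′ π ι ×-dec allAbove? v π ι) (words k′ n)
      ≡⟨ cong₂ _+_ (occurrences-punchIn v σ k) (trans (count-above-punchIn v σ k′) (count-atLeast σ inj (toℕ v) records k′)) ⟩
    occurrences k σ + (n ∸ toℕ v) C k′ ∎
    where
    open ≡-Reasoning
    π = map (punchIn v) σ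

  -- The conditions on σ for v ∷ map (punchIn v) σ to be good.
  Tail : ∀ {n} → Fin (suc n) → ℕ → Vec (Fin n) n → Set
  Tail {n} v r σ = Inj σ × (¬ Has132 σ × (Records≥ (toℕ v) σ × occ k σ + (n ∸ toℕ v) C k′ ≡ r))

  tail? : ∀ {n} (v : Fin (suc n)) r (σ : Vec (Fin n) n) → Dec (Tail v r σ)
  tail? {n} v r σ = isPerm? σ ×-dec (¬? (contains132? σ) ×-dec (records≥? (toℕ v) σ ×-dec (occ k σ + (n ∸ toℕ v) C k′ ℕ.≟ r)))

  -- Opaque, so that goals mentioning it are not normalised into lists of words.
  opaque
    startingWith : ∀ n → Fin (suc n) → ℕ → ℕ
    startingWith n v r = count (λ w → good? r (v ∷ w)) (words n (suc n))

    startingWith-def : ∀ n v r → startingWith n v r ≡ count (λ w → good? r (v ∷ w)) (words n (suc n))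
    startingWith-def n v r = refl

    f-suc : ∀ n r → f k (suc n) r ≡ ∑[ v < suc n ] startingWith n v r
    f-suc n r = count-words-suc {n = n} (good? r)

    startingWith≡count-tails : ∀ n (v : Fin (suc n)) r → startingWith n v r ≡ count (tail? v r) (words n n)
    startingWith≡count-tails n v r = begin
      count (λ w → good? r (v ∷ w)) (words n (suc n))
        ≡⟨ count-cong (λ w → good? r (v ∷ w)) (λ w → all? (λ x → ¬? (x Fin.≟ v)) w ×-dec good? r (v ∷ w))
             (λ g → proj₁ (Inj-∷⁻ (proj₁ g)) , g) proj₂ (words n (suc n)) ⟩
      count (λ w → all? (λ x → ¬? (x Fin.≟ v)) w ×-dec good? r (v ∷ w)) (words n (suc n))
        ≡⟨ count-avoiding n v (λ w → good? r (v ∷ w)) ⟩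
      count (λ σ → good? r (v ∷ map (punchIn v) σ)) (words n n)
        ≡⟨ count-cong (λ σ → good? r (v ∷ map (punchIn v) σ)) (tail? v r) to from (words n n) ⟩
      count (tail? v r) (words n n) ∎
      where
      open ≡-Reasoning
      to : ∀ {σ} → Good r (v ∷ map (punchIn v) σ) → Tail v r σ
      to {σ} (inj , no132 , occ≡r) =
        let σ-inj = Inj-punchIn⁻ v σ (proj₂ (Inj-∷⁻ inj))
            σ-no132 , records = avoids132-∷⁻ v σ no132
        in σ-inj , σ-no132 , records , trans (sym (occ-∷-punchIn v σ σ-inj records)) occ≡r
      from : ∀ {σ} → Tail v r σ → Good r (v ∷ map (punchIn v) σ)
      from {σ} (inj , no132 , records , occ≡r) =
        Inj-∷⁺ (All≢-punchIn v σ) (Inj-punchIn⁺ v σ inj) , avoids132-∷⁺ v σ no132 records , trans (occ-∷-punchIn v σ inj records) occ≡r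

  startingWith-zero : ∀ r → startingWith 0 zero r ≡ indicator (0 C k′ ℕ.≟ r)
  startingWith-zero r = trans (startingWith≡count-tails 0 zero r)
    (trans (count-[_] (tail? zero r) []) (indicator-cong (proj₂ ∘′ proj₂ ∘′ proj₂) (λ e → (λ ()) , (λ { (() , _) }) , (λ { (() , _) }) , e) _ _))

  module _ (n : ℕ) (v : Fin (suc (suc n))) (r : ℕ) where

    private
      c = (suc n ∸ toℕ v) C k′

    startingWith-suc-< : r ℕ.< c → startingWith (suc n) v r ≡ 0
    startingWith-suc-< r<c = trans (startingWith≡count-tails (suc n) v r)
      (count-none (tail? v r) (λ _ (_ , _ , _ , occ+c≡r) → ℕ.<⇒≱ r<c (subst (c ℕ.≤_) occ+c≡r (ℕ.m≤n+m c _))) (words (suc n) (suc n)))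

    -- The second letter u of a 132-avoiding permutation starting with v satisfies u ≤ v.
    startingWith-suc-≥ : c ℕ.≤ r → startingWith (suc n) v r ≡ ∑[ u < suc n ] (indicator (toℕ u ℕ.≤? toℕ v) * startingWith n u (r ∸ c))
    startingWith-suc-≥ c≤r = trans (startingWith≡count-tails (suc n) v r) (trans (count-words-suc {n = n} (tail? v r)) (sum-cong-≗ step))
      where
      step : ∀ u → count (λ w → tail? v r (u ∷ w)) (words n (suc n)) ≡ indicator (toℕ u ℕ.≤? toℕ v) * startingWith n u (r ∸ c)
      step u = trans (count-cong _ (λ w → good? (r ∸ c) (u ∷ w) ×-dec (toℕ u ℕ.≤? toℕ v)) to from (words n (suc n)))
                     (trans (count-×-dec (λ w → good? (r ∸ c) (u ∷ w)) _ (words n (suc n)))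
                            (cong (indicator (toℕ u ℕ.≤? toℕ v) *_) (sym (startingWith-def n u (r ∸ c)))))
        where
        to : ∀ {w} → Tail v r (u ∷ w) → Good (r ∸ c) (u ∷ w) × toℕ u ℕ.≤ toℕ v
        to {w} (inj , no132 , records , occ+c≡r) =
          (inj , no132 , trans (sym (ℕ.m+n∸n≡m _ c)) (cong (_∸ c) occ+c≡r)) , Records≥⇒head≤ u w inj (toℕ v) records
        from : ∀ {w} → Good (r ∸ c) (u ∷ w) × toℕ u ℕ.≤ toℕ v → Tail v r (u ∷ w)
        from {w} ((inj , no132 , occ≡r∸c) , u≤v) =
          inj , no132 , head≤⇒Records≥ u w inj no132 (toℕ v) u≤v , trans (cong (_+ c) occ≡r∸c) (ℕ.m∸n+n≡m c≤r)

module PathCounting (k′ : ℕ) where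

  open import Defs using (f)
  open BivariateSeries
  open WeightedPaths
  open Counting
  open FirstLetter k′
  open import Algebra.Bundles using (CommutativeRing)
  open import Data.Bool.Base using (true; false; if_then_else_; not)
  open import Data.Nat.Base as ℕ using (zero; suc; _+_; _*_; _∸_; _≤_; _<_; _<ᵇ_; s≤s; s≤s⁻¹)
  import Data.Nat.Properties as ℕ
  open import Data.Nat.Properties using (<ᵇ-reflects-<)
  open import Data.Nat.Combinatorics using (_C_)
  open import Data.Fin.Base using (Fin; zero; suc; toℕ; opposite)
  import Data.Fin.Properties as Fin
  import Data.Fin.Permutation as Perm
  open import Data.Integer.Base as ℤ using (+_)
  open import Relation.Nullary using (contradiction)
  open import Relation.Nullary.Reflects using (ofʸ; ofⁿ)
  open import Relation.Binary.PropositionalEquality using (_≡_; refl; cong; cong₂; trans; sym; subst; subst₂; module ≡-Reasoning)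
  open import Function.Base using (_∘_)
  open import Function.Bundles using (_⇔_; mk⇔; Equivalence)
  open import Algebra.Properties.CommutativeMonoid.Sum ℕ.+-0-commutativeMonoid using (sum-syntax; sum-cong-≗; sum-permute)

  weight : ℕ → ℕ
  weight h = h C k′

  ∑-opposite : ∀ n g → ∑[ i < n ] g i ≡ ∑[ i < n ] g (opposite i)
  ∑-opposite n g = sum-permute g Perm.reverse

  origin-0 : ∀ m → origin 0 m ≡ indicator (0 ℕ.≟ m)
  origin-0 zero    = refl
  origin-0 (suc m) = refl

  weight-opposite : ∀ n (h : Fin (suc (suc n))) → (suc n ∸ toℕ (opposite h)) C k′ ≡ weight (toℕ h)
  weight-opposite n h = cong (_C k′) (trans (cong (suc n ∸_) (Fin.opposite-prop h)) (ℕ.m∸[m∸n]≡n (s≤s⁻¹ (Fin.toℕ<n h))))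

  -- The next height h′ may drop by at most one exactly when the next letter does not exceed the first.
  <2+⇔opposite≤ : ∀ n (h : Fin (suc (suc n))) (h′ : Fin (suc n)) →
                  toℕ h < 2 + toℕ h′ ⇔ toℕ (opposite h′) ≤ toℕ (opposite h)
  <2+⇔opposite≤ n h h′ = subst₂ (λ a b → toℕ h < 2 + toℕ h′ ⇔ a ≤ b) (sym (Fin.opposite-prop h′)) (sym (Fin.opposite-prop h))
    (mk⇔ (λ h<2+h′ → ℕ.∸-monoʳ-≤ (suc n) (s≤s⁻¹ h<2+h′))
         (λ le → s≤s (ℕ.∸-cancelʳ-≤ (s≤s⁻¹ (Fin.toℕ<n h)) le)))

  -- A permutation of [n + 1] starting with v corresponds to a path starting at height n ∸ v.
  paths≡startingWith : ∀ n D → suc n ≤ D → ∀ (h : Fin (suc n)) r →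
                       paths D weight (toℕ h) (suc n) r ≡ startingWith n (opposite h) r
  paths≡startingWith zero (suc D) _ zero r with r <ᵇ weight 0 | <ᵇ-reflects-< r (weight 0)
  ... | true  | ofʸ r<w₀ = sym (trans (startingWith-zero r) (indicator-no (0 C k′ ℕ.≟ r) λ w₀≡r → ℕ.<-irrefl (sym w₀≡r) r<w₀))
  ... | false | ofⁿ r≮w₀ = begin
    origin 0 (r ∸ weight 0) + ∑ℕ.∑< (suc D) (λ _ → 0)   ≡⟨ cong₂ _+_ (origin-0 _) (∑ℕ.∑<-zero (suc D) λ _ _ → refl) ⟩
    indicator (0 ℕ.≟ r ∸ weight 0) + 0                  ≡⟨ ℕ.+-identityʳ _ ⟩
    indicator (0 ℕ.≟ r ∸ weight 0)                      ≡⟨ indicator-cong (λ 0≡r∸w₀ → ℕ.≤-antisym (ℕ.≮⇒≥ r≮w₀) (ℕ.m∸n≡0⇒m≤n (sym 0≡r∸w₀)))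
                                                                         (λ { refl → sym (ℕ.n∸n≡0 r) }) _ _ ⟩
    indicator (0 C k′ ℕ.≟ r)                            ≡⟨ startingWith-zero r ⟨
    startingWith 0 zero r                               ∎
    where open ≡-Reasoning
  paths≡startingWith (suc n) D 2+n≤D h r with toℕ h <ᵇ D | <ᵇ-reflects-< (toℕ h) D
  ... | false | ofⁿ h≮D = contradiction (ℕ.<-≤-trans (Fin.toℕ<n h) 2+n≤D) h≮D
  ... | true  | _ with r <ᵇ weight (toℕ h) | <ᵇ-reflects-< r (weight (toℕ h))
  ...   | true  | ofʸ r<w = sym (startingWith-suc-< n (opposite h) r (subst (r <_) (sym (weight-opposite n h)) r<w))
  ...   | false | ofⁿ r≮w = begin
    (if toℕ h <ᵇ 1 then origin (suc n) r′ else 0) + ∑ℕ.∑< D step        ≡⟨ cong₂ _+_ (if-zero (toℕ h <ᵇ 1) λ _ → refl) truncate ⟩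
    ∑[ h′ < suc n ] step (toℕ h′)                                        ≡⟨ sum-cong-≗ (λ h′ → by-opposite h′) ⟩
    ∑[ h′ < suc n ] (indicator (toℕ (opposite h′) ℕ.≤? toℕ (opposite h)) * startingWith n (opposite h′) r′)
                                                                         ≡⟨ ∑-opposite (suc n) (λ u → indicator (toℕ u ℕ.≤? toℕ (opposite h)) * startingWith n u r′) ⟨
    ∑[ u < suc n ] (indicator (toℕ u ℕ.≤? toℕ (opposite h)) * startingWith n u r′)
                                                                         ≡⟨ startingWith-suc-≥′ ⟨
    startingWith (suc n) (opposite h) r                                  ∎
    where
    open ≡-Reasoning
    r′ = r ∸ weight (toℕ h)
    step = λ h′ → if toℕ h <ᵇ 2 + h′ then paths D weight h′ (suc n) r′ else 0
    truncate : ∑ℕ.∑< D step ≡ ∑ℕ.∑< (suc n) step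
    truncate = ∑ℕ.∑<-truncate step (s≤s⁻¹ (ℕ.m≤n⇒m≤1+n 2+n≤D)) λ h′ n<h′ →
      if-zero (toℕ h <ᵇ 2 + h′) λ _ → paths-vanish D weight (suc n) h′ r′ n<h′
    by-opposite : ∀ h′ → step (toℕ h′) ≡ indicator (toℕ (opposite h′) ℕ.≤? toℕ (opposite h)) * startingWith n (opposite h′) r′
    by-opposite h′ with toℕ h <ᵇ 2 + toℕ h′ | <ᵇ-reflects-< (toℕ h) (2 + toℕ h′)
    ... | true  | ofʸ lt = trans (paths≡startingWith n D (ℕ.<⇒≤ 2+n≤D) h′ r′)
      (sym (trans (cong (_* S) (indicator-yes d (Equivalence.to (<2+⇔opposite≤ n h h′) lt))) (ℕ.*-identityˡ S)))
      where
      d = toℕ (opposite h′) ℕ.≤? toℕ (opposite h)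
      S = startingWith n (opposite h′) r′
    ... | false | ofⁿ ¬lt = sym (cong (_* S) (indicator-no d (¬lt ∘ Equivalence.from (<2+⇔opposite≤ n h h′))))
      where
      d = toℕ (opposite h′) ℕ.≤? toℕ (opposite h)
      S = startingWith n (opposite h′) r′
    startingWith-suc-≥′ : startingWith (suc n) (opposite h) r ≡ ∑[ u < suc n ] (indicator (toℕ u ℕ.≤? toℕ (opposite h)) * startingWith n u r′)
    startingWith-suc-≥′ rewrite sym (weight-opposite n h) = startingWith-suc-≥ n (opposite h) r (ℕ.≮⇒≥ r≮w)

  allPaths≡f : ∀ D n → n ≤ D → ∀ r → allPaths D weight n r ≡ + f k n r
  allPaths≡f D zero _ r = trans (allPaths-coeff D weight 0 r)
    (trans (cong (λ s → 1# 0 r ℤ.+ + s) (∑ℕ.∑<-zero D λ _ _ → refl)) (origin≡f r))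
    where
    open CommutativeRing seriesRing using (1#)
    origin≡f : ∀ r → 1# 0 r ℤ.+ + 0 ≡ + f k 0 r
    origin≡f zero    = cong +_ (sym (f-zero 0))
    origin≡f (suc r) = cong +_ (sym (f-zero (suc r)))
  allPaths≡f D (suc n) n<D r = trans (allPaths-coeff D weight (suc n) r) (cong +_ (begin
    ∑ℕ.∑< D (λ h → paths D weight h (suc n) r)           ≡⟨ ∑ℕ.∑<-truncate _ n<D (λ h n<h → paths-vanish D weight (suc n) h r n<h) ⟩
    ∑[ h < suc n ] paths D weight (toℕ h) (suc n) r      ≡⟨ sum-cong-≗ (λ h → paths≡startingWith n D n<D h r) ⟩
    ∑[ h < suc n ] startingWith n (opposite h) r         ≡⟨ ∑-opposite (suc n) (λ v → startingWith n v r) ⟨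
    ∑[ v < suc n ] startingWith n v r                    ≡⟨ f-suc n r ⟨
    f k (suc n) r                                        ∎))
    where open ≡-Reasoning

module Exponents where

  open import Defs
  open BivariateSeries
  open WeightedPaths using (contFrac)
  open import Algebra.Bundles using (CommutativeRing)
  open import Data.Nat.Base as ℕ using (ℕ; zero; suc; _≤_; _<_; _≤ᵇ_)
  import Data.Nat.Properties as ℕ
  open import Data.Nat.Combinatorics using (_C_; nCk≡nC[n∸k]; nCn≡1)
  open import Data.Bool.Base using (true; false)
  open import Function.Base using (_∘_)
  open import Relation.Nullary using (contradiction)
  open import Relation.Nullary.Reflects using (ofʸ)
  open import Relation.Binary.PropositionalEquality as ≡ using (_≡_; refl; cong)

  open CommutativeRing seriesRing hiding (zero) renaming (refl to ≈-refl; sym to ≈-sym; trans to ≈-trans)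

  contFrac-cong : ∀ D {w w′} → (∀ j → w j ≡ w′ j) → contFrac w D ≈ contFrac w′ D
  contFrac-cong zero    w≡w′ = ≈-refl
  contFrac-cong (suc D) w≡w′ = GeomX.geom-cong (yPowTimes-cong (w≡w′ 0) (contFrac-cong D (w≡w′ ∘ suc)))

  cf≈contFrac : ∀ k d i → cf k d i ≈ contFrac (λ j → cExp k (i ℕ.+ j)) d
  cf≈contFrac k zero    i = ≈-refl
  cf≈contFrac k (suc d) i = GeomX.geom-cong (yPowTimes-cong (cong (cExp k) (≡.sym (ℕ.+-identityʳ i)))
    (≈-trans (cf≈contFrac k d (suc i)) (contFrac-cong d λ j → cong (cExp k) (≡.sym (ℕ.+-suc i j)))))

  contFrac-zero-weights : ∀ j D w → (∀ i → i < j → w i ≡ 0) → contFrac w (j ℕ.+ D) ≈ GeomX.iterate j (contFrac (λ i → w (j ℕ.+ i)) D)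
  contFrac-zero-weights zero    D w _  = ≈-refl
  contFrac-zero-weights (suc j) D w w≡0 = GeomX.geom-cong (≈-trans (yPowTimes-cong (w≡0 0 (ℕ.s≤s ℕ.z≤n)) ≈-refl)
    (≈-trans (yPowTimes-zero _) (contFrac-zero-weights j D (w ∘ suc) λ i i<j → w≡0 (suc i) (ℕ.s≤s i<j))))

  m<k⇒mCk≡0 : ∀ {m k} → m < k → m C k ≡ 0
  m<k⇒mCk≡0 {m} {k} m<k with k ≤ᵇ m | ℕ.≤ᵇ-reflects-≤ k m
  ... | true  | ofʸ k≤m = contradiction m<k (ℕ.≤⇒≯ k≤m)
  ... | false | _       = refl

  module _ (k′ : ℕ) where

    open PathCounting k′ using (weight)

    weight≡cExp : ∀ j → weight (k′ ℕ.+ suc j) ≡ cExp (suc k′) (1 ℕ.+ j)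
    weight≡cExp j = ≡.trans (nCk≡nC[n∸k] (ℕ.m≤m+n k′ (suc j))) (cong ((k′ ℕ.+ suc j) C_) (ℕ.m+n∸m≡n k′ (suc j)))

    -- The weights h C k′ vanish below height k′ and are 1 at height k′ (the factor y of G);
    -- above it they are the exponents cExp of G.
    contFrac≈iterate : ∀ d → contFrac weight (k′ ℕ.+ suc d) ≈ GeomX.iterate (suc k′) (Gconv (suc k′) d)
    contFrac≈iterate d = ≈-trans (contFrac-zero-weights k′ (suc d) weight λ i i<k′ → m<k⇒mCk≡0 i<k′)
      (≈-trans (GeomX.iterate-cong k′ top) (≈-sym (GeomX.iterate-sucʳ k′ (Gconv (suc k′) d))))
      where
      top : contFrac (λ i → weight (k′ ℕ.+ i)) (suc d) ≈ geomX (Gconv (suc k′) d)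
      top = GeomX.geom-cong (≈-trans (yPowTimes-cong (≡.trans (cong (_C k′) (ℕ.+-identityʳ k′)) (nCn≡1 k′))
                                                (≈-trans (contFrac-cong d weight≡cExp) (≈-sym (cf≈contFrac (suc k′) d 1))))
                       (≈-trans (yPowTimes≈Y* 1 _) (≈-trans (*-congʳ (≈-sym yS≈Y1)) (≈-sym (⊗≈* yS _)))))

open import Defs
open import Data.Nat using (ℕ; zero; suc; _≤_; _+_)
import Data.Nat.Properties as ℕ
open import Data.Integer using (+_)
open import Data.Product using (∃-syntax; _,_)
open import Relation.Binary.PropositionalEquality using (_≡_; module ≡-Reasoning)
open BivariateSeries using (module GeomX)
open RightHandSide using (rhs≈iterate)
open WeightedPaths using (allPaths; contFrac; contFrac≈allPaths)
open Exponents using (contFrac≈iterate)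

mainTheorem4 : (k : ℕ) → 1 ≤ k → (n r : ℕ) →
    ∃[ D ] ((d : ℕ) → D ≤ d → + (f k n r) ≡ rhs k d n r)
mainTheorem4 zero    ()
-- The depth-d convergent yields the path continued fraction of depth k′ + 1 + d, exact in lengths n ≤ d.
mainTheorem4 (suc k′) _ n r = n , agreement
  where
  open PathCounting k′ using (weight; allPaths≡f)
  open ≡-Reasoning
  agreement : ∀ d → n ≤ d → + f (suc k′) n r ≡ rhs (suc k′) d n r
  agreement d n≤d = begin
    + f (suc k′) n r                               ≡⟨ allPaths≡f D n n≤D r ⟨
    allPaths D weight n r                          ≡⟨ contFrac≈allPaths D weight n r ⟨
    contFrac weight D n r                          ≡⟨ contFrac≈iterate k′ d n r ⟩
    GeomX.iterate (suc k′) (Gconv (suc k′) d) n r  ≡⟨ rhs≈iterate k′ d n r ⟨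
    rhs (suc k′) d n r                             ∎
    where
    D = k′ + suc d
    n≤D : n ≤ D
    n≤D = ℕ.≤-trans n≤d (ℕ.≤-trans (ℕ.n≤1+n d) (ℕ.m≤n+m (suc d) k′))
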